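{- For all $p, k \in \mathbb{N}$, $P_{DP}(K_p \vee C_{2k+1}, m) = P(K_p \vee C_{2k+1}, m)$ for every $m \in \mathbb{N}$. Consequently, $\tau_{DP}(K_p \vee C_{2k+1}) = \chi(K_p \vee C_{2k+1}) = 3 + p$.
   Context: All graphs are finite and simple; $K_p \vee C_{2k+1}$ is the join of the complete graph $K_p$ and the odd cycle $C_{2k+1}$. A cover of a graph $G$ is a pair $\mathcal{H}=(L,H)$ where $H$ is a graph and $L: V(G) \to \mathcal{P}(V(H))$ satisfies: (1) $\{L(u): u \in V(G)\}$ is a partition of $V(H)$ into $|V(G)|$ parts; (2) $H[L(u)]$ is complete for each $u$; (3) if there is an edge of $H$ between $L(u)$ and $L(v)$ with $u \neq v$, then $uv \in E(G)$; (4) if $uv \in E(G)$, the edges of $H$ between $L(u)$ and $L(v)$ form a (possibly empty) matching. The cover is $m$-fold if $|L(u)|=m$ for all $u$. An $\mathcal{H}$-coloring of $G$ is an independent set of $H$ of size $|V(G)|$. $P_{DP}(G,m)$ is the minimum number of $\mathcal{H}$-colorings over all $m$-fold covers of $G$; $P(G,m)$ is the chromatic polynomial. $\tau_{DP}(G)$ is the smallest $N \geq \chi(G)$ such that $P_{DP}(G,m)=P(G,m)$ for all $m \geq N$ (and $\infty$ if no such $N$ exists). -}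

module Defs where

open import Data.Nat using (ℕ; zero; suc; _+_; _*_; _≤_; _<_; _%_)
open import Data.Fin using (Fin; toℕ; splitAt)
import Data.Fin.Properties as FinP
open import Data.Fin.Subset using (Subset; _∈_; ∣_∣)
open import Data.Fin.Subset.Properties using (_∈?_)
open import Data.Vec using (Vec; []; _∷_; lookup)
open import Data.List using (List; []; _∷_; [_]; map; _++_; concatMap; length; filter; allFin)
open import Data.Bool using (Bool; true; false)
import Data.Bool.Properties as BoolP
open import Data.Sum using (_⊎_; inj₁; inj₂)
open import Data.Product using (Σ; _×_; _,_; ∃)
open import Relation.Nullary using (¬_; Dec)
open import Relation.Nullary.Decidable using (⌊_⌋; ¬?; _→-dec_; _×-dec_)
open import Relation.Binary.PropositionalEquality using (_≡_; _≢_)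
import Data.Nat.Properties as NatP

record Graph (n : ℕ) : Set where
  field
    adj   : Fin n → Fin n → Bool
    sym   : ∀ u v → adj u v ≡ adj v u
    irrefl : ∀ u → adj u u ≡ false
open Graph public

count : {A : Set} {P : A → Set} → ((x : A) → Dec (P x)) → List A → ℕ
count P? xs = length (filter P? xs)

allColorings : (n m : ℕ) → List (Vec (Fin m) n)
allColorings zero    m = [ [] ]
allColorings (suc n) m = concatMap (λ c → map (c ∷_) (allColorings n m)) (allFin m)

Proper : ∀ {n m} → Graph n → Vec (Fin m) n → Set
Proper G c = ∀ u v → adj G u v ≡ true → lookup c u ≢ lookup c v

proper? : ∀ {n m} (G : Graph n) (c : Vec (Fin m) n) → Dec (Proper G c)
proper? G c = FinP.all? λ u → FinP.all? λ v →
  (adj G u v BoolP.≟ true) →-dec ¬? (lookup c u FinP.≟ lookup c v)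

chromPoly : ∀ {n} → Graph n → ℕ → ℕ
chromPoly {n} G m = count (proper? G) (allColorings n m)

IsChromaticNumber : ∀ {n} → Graph n → ℕ → Set
IsChromaticNumber G c = (0 < chromPoly G c) × (∀ c' → c' < c → chromPoly G c' ≡ 0)

-- m-fold covers (DP-coloring).  V(H) = Fin N; the vertex x of H belongs to
-- the part L(lab x), i.e. L(u) = { x | lab x ≡ u }.

record Cover {n : ℕ} (G : Graph n) (m : ℕ) : Set where
  field
    N      : ℕ
    Hadj   : Fin N → Fin N → Bool
    Hsym   : ∀ x y → Hadj x y ≡ Hadj y x
    Hirr   : ∀ x → Hadj x x ≡ false
    lab    : Fin N → Fin n
    fold   : ∀ u → count (λ x → lab x FinP.≟ u) (allFin N) ≡ m
    clique : ∀ x y → lab x ≡ lab y → x ≢ y → Hadj x y ≡ true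
    over   : ∀ x y → lab x ≢ lab y → Hadj x y ≡ true → adj G (lab x) (lab y) ≡ true
    match  : ∀ x y z → lab x ≢ lab y → adj G (lab x) (lab y) ≡ true →
             lab y ≡ lab z → Hadj x y ≡ true → Hadj x z ≡ true → y ≡ z
open Cover public

allSubsets : (N : ℕ) → List (Subset N)
allSubsets zero    = [ [] ]
allSubsets (suc N) = map (true ∷_) (allSubsets N) ++ map (false ∷_) (allSubsets N)

Independent : ∀ {N} → (Fin N → Fin N → Bool) → Subset N → Set
Independent Hadj S = ∀ x y → x ∈ S → y ∈ S → Hadj x y ≡ false

independent? : ∀ {N} (Hadj : Fin N → Fin N → Bool) (S : Subset N) → Dec (Independent Hadj S)
independent? Hadj S = FinP.all? λ x → FinP.all? λ y →
  (x ∈? S) →-dec ((y ∈? S) →-dec (Hadj x y BoolP.≟ false))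

IsHColoring : ∀ {n m} {G : Graph n} (ℋ : Cover G m) → Subset (N ℋ) → Set
IsHColoring {n} ℋ S = (∣ S ∣ ≡ n) × Independent (Hadj ℋ) S

isHColoring? : ∀ {n m} {G : Graph n} (ℋ : Cover G m) (S : Subset (N ℋ)) → Dec (IsHColoring ℋ S)
isHColoring? {n} ℋ S = (∣ S ∣ NatP.≟ n) ×-dec independent? (Hadj ℋ) S

numHColorings : ∀ {n m} {G : Graph n} → Cover G m → ℕ
numHColorings ℋ = count (isHColoring? ℋ) (allSubsets (N ℋ))

IsDPColorFunctionValue : ∀ {n} → Graph n → ℕ → ℕ → Set
IsDPColorFunctionValue G m v =
  (Σ (Cover G m) λ ℋ → numHColorings ℋ ≡ v) × (∀ (ℋ : Cover G m) → v ≤ numHColorings ℋ)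

DPEqualsChrom : ∀ {n} → Graph n → ℕ → Set
DPEqualsChrom G m = IsDPColorFunctionValue G m (chromPoly G m)

IsTauDP : ∀ {n} → Graph n → ℕ → Set
IsTauDP G t =
  (∀ c → IsChromaticNumber G c → c ≤ t) ×
  (∀ m → t ≤ m → DPEqualsChrom G m) ×
  (∀ t' → (∀ c → IsChromaticNumber G c → c ≤ t') → t' < t →
     ¬ (∀ m → t' ≤ m → DPEqualsChrom G m))

-- cycle C_L on Fin L (vertices 0..L-1, i ~ i+1 mod L); simple for L ≥ 3
cycleAdj : (L : ℕ) → Fin L → Fin L → Bool
cycleAdj (suc L) i j =
  ⌊ suc (toℕ i) % suc L NatP.≟ toℕ j ⌋ Data.Bool.∨ ⌊ suc (toℕ j) % suc L NatP.≟ toℕ i ⌋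
  where import Data.Bool

completeAdj : (p : ℕ) → Fin p → Fin p → Bool
completeAdj p i j = Data.Bool.not ⌊ i FinP.≟ j ⌋
  where import Data.Bool

joinAdj : (p L : ℕ) → Fin (p + L) → Fin (p + L) → Bool
joinAdj p L x y with splitAt p x | splitAt p y
... | inj₁ i | inj₁ j = completeAdj p i j
... | inj₂ i | inj₂ j = cycleAdj L i j
... | inj₁ _ | inj₂ _ = true
... | inj₂ _ | inj₁ _ = true

-- Let ℋ be an m-fold cover of K_p ∨ C_(2k+1) and count its H-colorings as transversals of the
-- lists L(u), clique vertices first. Edges between two lists form a matching, so every choice of
-- a clique vertex removes at most one vertex from each later list: ℋ has at least
-- m(m-1)⋯(m-p+1) times as many transversals as some (m-p)-fold cover of the odd cycle. On a cycle,
-- fixing one vertex leaves a path of matched lists, along which three lower bounds for the number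
-- of completions (in total, through any single vertex, and with one vertex deleted) propagate
-- independently of the matchings. On the canonical cover, whose matchings are all the identity,
-- the same count is computed exactly; for an odd cycle it equals the lower bound. As the canonical
-- cover has exactly P(G, m) H-colorings, P_DP(G, m) = P(G, m) for every m, and since the bound
-- vanishes precisely for m < p + 3, χ(G) = τ_DP(G) = p + 3.

module Submission where

open import Data.Nat
open import Data.Nat.Properties
open import Algebra.Properties.CommutativeSemigroup +-commutativeSemigroup using (interchange; x∙yz≈y∙xz)
open import Data.Nat.Solver using (module +-*-Solver)
open import Data.Nat.DivMod using (m<n⇒m%n≡m; n%n≡0)
open import Data.Bool using (Bool; true; false; not; _∧_; _∨_; if_then_else_)
import Data.Bool.Properties as BoolP
open import Data.Fin using (Fin; zero; suc; toℕ; _↑ˡ_; _↑ʳ_; splitAt; fromℕ<; combine; remQuot)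
import Data.Fin.Properties as FinP
open import Data.Fin.Subset using (Subset; ∣_∣) renaming (_∈_ to _∈ₛ_)
import Data.Fin.Subset.Properties as SubP
open import Data.List using (List; []; _∷_; _++_; length; filter; map; concatMap; take; allFin)
import Data.List as L
import Data.List.Properties as LP
open import Data.List.Properties using (filter-all; filter-notAll; filter-none; length-map; length-++)
open import Data.List.Membership.Propositional using (_∈_; lose; find)
open import Data.List.Membership.Propositional.Properties
  using (∈-filter⁺; ∈-filter⁻; ∈-map⁺; ∈-map⁻; ∈-++⁻; ∈-++⁺ˡ; ∈-++⁺ʳ; ∈-allFin)
open import Data.List.Relation.Unary.Any using (Any; here; there; any?)
import Data.List.Relation.Unary.Any as Any
open import Data.List.Relation.Unary.All using (All; []; _∷_; all?)
import Data.List.Relation.Unary.All as All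
import Data.List.Relation.Unary.All.Properties as AllP
open import Data.List.Relation.Unary.AllPairs using ([]; _∷_)
open import Data.List.Relation.Unary.Unique.Propositional using (Unique)
open import Data.List.Relation.Binary.Sublist.Propositional using (_⊆_; []; _∷_; _∷ʳ_; ⊆-refl; ⊆-trans)
import Data.List.Relation.Binary.Sublist.Propositional as Sublist
open import Data.List.Relation.Binary.Sublist.Propositional.Properties using (filter-⊆; take-⊆; filter⁺)
import Data.List.Relation.Unary.Unique.Propositional.Properties as UP
open import Data.Vec using (Vec; []; _∷_; lookup)
import Data.Vec as V
import Data.Vec.Properties as VP
open import Data.Vec.Relation.Binary.Pointwise.Inductive using (Pointwise; [];  _∷_)
import Data.Vec.Relation.Binary.Pointwise.Inductive as Pointwise
open import Data.Product using (_×_; _,_; proj₁; proj₂; ∃)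
open import Data.Sum using (_⊎_; inj₁; inj₂)
open import Data.Unit using (⊤; tt)
open import Data.Empty using (⊥; ⊥-elim)
open import Relation.Nullary using (¬_; Dec; yes; no; does; ¬?)
open import Relation.Nullary.Decidable using (⌊_⌋; decidable-stable; dec-true; dec-false; isYes≗does)
open import Relation.Unary using (Pred; Decidable)
open import Relation.Binary.PropositionalEquality
open import Relation.Binary.Definitions using (DecidableEquality)
open import Function using (_∘_; id)
open import Level using (0ℓ)
open import Defs hiding (sym)

module Lists where

  private
    variable
      A B : Set

  ∑ : List A → (A → ℕ) → ℕ
  ∑ [] f = 0
  ∑ (x ∷ xs) f = f x + ∑ xs f

  ∑-cong : (xs : List A) {f g : A → ℕ} → (∀ {x} → x ∈ xs → f x ≡ g x) → ∑ xs f ≡ ∑ xs g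
  ∑-cong [] h = refl
  ∑-cong (x ∷ xs) h = cong₂ _+_ (h (here refl)) (∑-cong xs (h ∘ there))

  ∑-mono : (xs : List A) {f g : A → ℕ} → (∀ {x} → x ∈ xs → f x ≤ g x) → ∑ xs f ≤ ∑ xs g
  ∑-mono [] h = z≤n
  ∑-mono (x ∷ xs) h = +-mono-≤ (h (here refl)) (∑-mono xs (h ∘ there))

  ∑-map : (xs : List A) (g : A → B) (f : B → ℕ) → ∑ (map g xs) f ≡ ∑ xs (f ∘ g)
  ∑-map [] g f = refl
  ∑-map (x ∷ xs) g f = cong (f (g x) +_) (∑-map xs g f)

  ∑-+ : (xs : List A) (f g : A → ℕ) → ∑ xs (λ x → f x + g x) ≡ ∑ xs f + ∑ xs g
  ∑-+ [] f g = refl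
  ∑-+ (x ∷ xs) f g = trans (cong (f x + g x +_) (∑-+ xs f g)) (interchange (f x) (g x) (∑ xs f) (∑ xs g))

  ∑-const : (xs : List A) (c : ℕ) → ∑ xs (λ _ → c) ≡ length xs * c
  ∑-const [] c = refl
  ∑-const (x ∷ xs) c = cong (c +_) (∑-const xs c)

  ∑-ones : (xs : List A) → ∑ xs (λ _ → 1) ≡ length xs
  ∑-ones xs = trans (∑-const xs 1) (*-identityʳ _)

  ∑-≥ : (xs : List A) {f : A → ℕ} (c : ℕ) → (∀ {x} → x ∈ xs → c ≤ f x) → length xs * c ≤ ∑ xs f
  ∑-≥ xs {f} c h = subst (_≤ ∑ xs f) (∑-const xs c) (∑-mono xs h)

  ∑-≤ : (xs : List A) {f : A → ℕ} (c : ℕ) → (∀ {x} → x ∈ xs → f x ≤ c) → ∑ xs f ≤ length xs * c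
  ∑-≤ xs {f} c h = subst (∑ xs f ≤_) (∑-const xs c) (∑-mono xs h)

  ∑-swap : (xs : List A) (ys : List B) (f : A → B → ℕ) →
           ∑ xs (λ x → ∑ ys (f x)) ≡ ∑ ys (λ y → ∑ xs (λ x → f x y))
  ∑-swap [] ys f = sym (trans (∑-const ys 0) (*-zeroʳ (length ys)))
  ∑-swap (x ∷ xs) ys f = begin
    ∑ ys (f x) + ∑ xs (λ x → ∑ ys (f x))        ≡⟨ cong (∑ ys (f x) +_) (∑-swap xs ys f) ⟩
    ∑ ys (f x) + ∑ ys (λ y → ∑ xs (λ x → f x y)) ≡⟨ sym (∑-+ ys (f x) _) ⟩
    ∑ ys (λ y → f x y + ∑ xs (λ x → f x y))     ∎
    where open ≡-Reasoning

  when : Bool → ℕ → ℕ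
  when true v = v
  when false v = 0

  module _ (b : A → Bool) where

    ∑-when-false : {L : List A} (g : A → ℕ) → (∀ {x} → x ∈ L → b x ≡ false) → ∑ L (λ x → when (b x) (g x)) ≡ 0
    ∑-when-false {L} g h =
      trans (∑-cong L (λ x∈ → cong (λ c → when c (g _)) (h x∈))) (trans (∑-const L 0) (*-zeroʳ (length L)))

    ∑-when-≥ : (v : ℕ) {L : List A} {x : A} → x ∈ L → b x ≡ true → v ≤ ∑ L (λ x → when (b x) v)
    ∑-when-≥ v (here refl) bx rewrite bx = m≤m+n v _
    ∑-when-≥ v (there x∈) bx = ≤-trans (∑-when-≥ v x∈ bx) (m≤n+m _ _)

    ∑-when-≤ : (v : ℕ) {L : List A} → Unique L →
               (∀ {x x′} → x ∈ L → x′ ∈ L → b x ≡ true → b x′ ≡ true → x ≡ x′) →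
               ∑ L (λ x → when (b x) v) ≤ v
    ∑-when-≤ v {[]} u h = z≤n
    ∑-when-≤ v {x ∷ L} (x∉L ∷ u) h with b x in bx
    ... | false = ∑-when-≤ v u (λ p q → h (there p) (there q))
    ... | true = ≤-reflexive (trans (cong (v +_) (∑-when-false (λ _ → v) others)) (+-identityʳ v))
      where
      others : ∀ {x′} → x′ ∈ L → b x′ ≡ false
      others x′∈ = BoolP.¬-not (λ bx′ → All.lookup x∉L x′∈ (h (here refl) (there x′∈) bx bx′))

  length-concatMap : (xs : List A) (f : A → List B) → length (concatMap f xs) ≡ ∑ xs (length ∘ f)
  length-concatMap [] f = refl
  length-concatMap (x ∷ xs) f = trans (length-++ (f x)) (cong (length (f x) +_) (length-concatMap xs f))

  module _ {P : Pred A 0ℓ} (P? : Decidable P) where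

    ∑-partition : (xs : List A) (f : A → ℕ) → ∑ xs f ≡ ∑ (filter P? xs) f + ∑ (filter (¬? ∘ P?) xs) f
    ∑-partition [] f = refl
    ∑-partition (x ∷ xs) f with P? x
    ... | yes _ = trans (cong (f x +_) (∑-partition xs f)) (sym (+-assoc (f x) _ _))
    ... | no _  = trans (cong (f x +_) (∑-partition xs f)) (x∙yz≈y∙xz (f x) (∑ (filter P? xs) f) (∑ (filter (¬? ∘ P?) xs) f))

    length-partition : (xs : List A) → length xs ≡ length (filter P? xs) + length (filter (¬? ∘ P?) xs)
    length-partition xs = trans (sym (∑-ones xs)) (trans (∑-partition xs (λ _ → 1))
                            (cong₂ _+_ (∑-ones (filter P? xs)) (∑-ones (filter (¬? ∘ P?) xs))))

  module _ {A : Set} where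

    filter-cong : {P Q : Pred A 0ℓ} (P? : Decidable P) (Q? : Decidable Q) (xs : List A) →
                 (∀ {x} → x ∈ xs → P x → Q x) → (∀ {x} → x ∈ xs → Q x → P x) → filter P? xs ≡ filter Q? xs
    filter-cong P? Q? [] pq qp = refl
    filter-cong P? Q? (x ∷ xs) pq qp with P? x | Q? x
    ... | yes p | yes q = cong (x ∷_) (filter-cong P? Q? xs (pq ∘ there) (qp ∘ there))
    ... | yes p | no ¬q = ⊥-elim (¬q (pq (here refl) p))
    ... | no ¬p | yes q = ⊥-elim (¬p (qp (here refl) q))
    ... | no ¬p | no ¬q = filter-cong P? Q? xs (pq ∘ there) (qp ∘ there)

    unique-pairwise-equal-length-≤1 : {xs : List A} → Unique xs → (∀ {x y} → x ∈ xs → y ∈ xs → x ≡ y) → length xs ≤ 1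
    unique-pairwise-equal-length-≤1 {[]} u h = z≤n
    unique-pairwise-equal-length-≤1 {x ∷ []} u h = s≤s z≤n
    unique-pairwise-equal-length-≤1 {x ∷ y ∷ xs} ((x≢y ∷ _) ∷ _) h = ⊥-elim (x≢y (h (here refl) (there (here refl))))

    length-filter-≤1 : {P : Pred A 0ℓ} (P? : Decidable P) {xs : List A} → Unique xs →
                (∀ {x y} → x ∈ xs → y ∈ xs → P x → P y → x ≡ y) → length (filter P? xs) ≤ 1
    length-filter-≤1 P? {xs} u h = unique-pairwise-equal-length-≤1 (UP.filter⁺ P? u)
      (λ a b → h (proj₁ (∈-filter⁻ P? {xs = xs} a)) (proj₁ (∈-filter⁻ P? {xs = xs} b))
                 (proj₂ (∈-filter⁻ P? {xs = xs} a)) (proj₂ (∈-filter⁻ P? {xs = xs} b)))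

    length-≤-suc-length-filter : {P : Pred A 0ℓ} (P? : Decidable P) {xs : List A} → Unique xs →
               (∀ {x y} → x ∈ xs → y ∈ xs → ¬ P x → ¬ P y → x ≡ y) → length xs ≤ suc (length (filter P? xs))
    length-≤-suc-length-filter P? {xs} u h = begin
        length xs ≡⟨ length-partition P? xs ⟩
        length (filter P? xs) + length (filter (¬? ∘ P?) xs) ≤⟨ +-monoʳ-≤ (length (filter P? xs))
            (length-filter-≤1 (¬? ∘ P?) u h) ⟩
        length (filter P? xs) + 1 ≡⟨ +-comm _ 1 ⟩
        suc (length (filter P? xs)) ∎
      where open ≤-Reasoning

  module Removal (_≟_ : DecidableEquality A) where

    ≢? : (z0 : A) → Decidable (λ y → ¬ y ≡ z0)
    ≢? z0 y = ¬? (y ≟ z0)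

    remove : A → List A → List A
    remove z0 = filter (≢? z0)

    length-remove-< : {L : List A} {z0 : A} → z0 ∈ L → length (remove z0 L) < length L
    length-remove-< {L} {z0} z0∈L = filter-notAll (≢? z0) L (Any.map (λ z0≡y y≢z0 → y≢z0 (sym z0≡y)) z0∈L)

    length-≤-suc-length-remove : {L : List A} (z0 : A) → Unique L → length L ≤ suc (length (remove z0 L))
    length-≤-suc-length-remove z0 u = length-≤-suc-length-filter (≢? z0) u
        (λ _ _ a b → trans (decidable-stable (_ ≟ z0) a) (sym (decidable-stable (_ ≟ z0) b)))

    remove-⊆ : (z0 : A) (L : List A) → remove z0 L ⊆ L
    remove-⊆ z0 L = filter-⊆ (≢? z0) L

    ∈-remove-⊆ : ∀ {z0 z} L → z ∈ remove z0 L → z ∈ L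
    ∈-remove-⊆ {z0} L z∈ = proj₁ (∈-filter⁻ (≢? z0) {xs = L} z∈)

    ∈-remove-≢ : ∀ {z0 z} L → z ∈ remove z0 L → z ≢ z0
    ∈-remove-≢ {z0} L z∈ = proj₂ (∈-filter⁻ (≢? z0) {xs = L} z∈)

    ∑-≤-remove-unhit : (B : List A) (g hB : A → ℕ) (y* : A) → (∀ {y} → y ∈ B → g y ≤ hB y) → g y* ≡ 0 →
               ∑ B g ≤ ∑ (remove y* B) hB
    ∑-≤-remove-unhit [] g hB y* le g0 = z≤n
    ∑-≤-remove-unhit (y ∷ B) g hB y* le g0 with y ≟ y*
    ... | yes refl rewrite g0 = ∑-≤-remove-unhit B g hB y* (le ∘ there) g0
    ... | no _ = +-mono-≤ (le (here refl)) (∑-≤-remove-unhit B g hB y* (le ∘ there) g0)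

    ∑-remove : (B : List A) (h : A → ℕ) {y* : A} → Unique B → y* ∈ B → ∑ B h ≡ h y* + ∑ (remove y* B) h
    ∑-remove (y ∷ B) h {y*} (y∉ ∷ u) yin with y ≟ y*
    ... | yes refl = cong (h y +_) (sym (cong (λ M → ∑ M h) (filter-all (≢? y) (All.map (λ p e → p (sym e)) y∉))))
    ... | no ne with yin
    ...   | here eq = ⊥-elim (ne (sym eq))
    ...   | there yin' = trans (cong (h y +_) (∑-remove B h u yin')) (x∙yz≈y∙xz (h y) (h y*) _)

  module Injections (_≟_ : DecidableEquality B) where

    unique-length-≤ : {xs ys : List B} → Unique xs → (∀ {x} → x ∈ xs → x ∈ ys) → length xs ≤ length ys
    unique-length-≤ {[]} u sub = z≤n
    unique-length-≤ {x ∷ xs} {ys} (x∉xs ∷ u) sub = begin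
        suc (length xs)                  ≤⟨ s≤s (unique-length-≤ u sub′) ⟩
        suc (length (filter ≢x? ys))     ≤⟨ filter-notAll ≢x? ys (Any.map (λ x≡y y≢x → y≢x (sym x≡y)) (sub (here refl))) ⟩
        length ys                        ∎
      where
      open ≤-Reasoning
      ≢x? : Decidable (λ y → ¬ y ≡ x)
      ≢x? y = ¬? (y ≟ x)
      sub′ : ∀ {z} → z ∈ xs → z ∈ filter ≢x? ys
      sub′ z∈xs = ∈-filter⁺ ≢x? (sub (there z∈xs)) (λ z≡x → All.lookup x∉xs z∈xs (sym z≡x))

    unique-map⁺ : {xs : List A} (f : A → B) → Unique xs →
                  (∀ {x y} → x ∈ xs → y ∈ xs → f x ≡ f y → x ≡ y) → Unique (map f xs)
    unique-map⁺ {xs = []} f u inj = []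
    unique-map⁺ {xs = x ∷ xs} f (x∉xs ∷ u) inj =
      All.tabulate (λ fy∈ fx≡fy → distinct fy∈ fx≡fy) ∷ unique-map⁺ f u (λ a b → inj (there a) (there b))
      where
      distinct : ∀ {w} → w ∈ map f xs → f x ≡ w → ⊥
      distinct w∈ fx≡w with ∈-map⁻ f w∈
      ... | y , y∈xs , refl = All.lookup x∉xs y∈xs (inj (here refl) (there y∈xs) fx≡w)

    count-≤-injection : {P : Pred A 0ℓ} {Q : Pred B 0ℓ} (P? : Decidable P) (Q? : Decidable Q)
                        (xs : List A) (ys : List B) (f : A → B) → Unique xs →
                        (∀ {x} → x ∈ xs → P x → Q (f x)) →
                        (∀ {x} → x ∈ xs → P x → f x ∈ ys) →
                        (∀ {x y} → x ∈ xs → y ∈ xs → P x → P y → f x ≡ f y → x ≡ y) →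
                        length (filter P? xs) ≤ length (filter Q? ys)
    count-≤-injection P? Q? xs ys f u hq hy inj = begin
        length (filter P? xs)         ≡⟨ sym (length-map f (filter P? xs)) ⟩
        length (map f (filter P? xs)) ≤⟨ unique-length-≤ (unique-map⁺ f (UP.filter⁺ P? u) inj′) sub ⟩
        length (filter Q? ys)         ∎
      where
      open ≤-Reasoning
      inj′ : ∀ {x y} → x ∈ filter P? xs → y ∈ filter P? xs → f x ≡ f y → x ≡ y
      inj′ a b with ∈-filter⁻ P? {xs = xs} a | ∈-filter⁻ P? {xs = xs} b
      ... | a∈ , Pa | b∈ , Pb = inj a∈ b∈ Pa Pb
      sub : ∀ {z} → z ∈ map f (filter P? xs) → z ∈ filter Q? ys
      sub z∈ with ∈-map⁻ f z∈
      ... | x , x∈ , refl with ∈-filter⁻ P? {xs = xs} x∈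
      ... | x∈xs , Px = ∈-filter⁺ Q? (hy x∈xs Px) (hq x∈xs Px)

module Transversals where

  open Lists

  Sublists : {A : Set} {n : ℕ} → Vec (List A) n → Vec (List A) n → Set
  Sublists = Pointwise _⊆_

  ∑-mono-⊆ : {A : Set} {xs ys : List A} (f : A → ℕ) → xs ⊆ ys → ∑ xs f ≤ ∑ ys f
  ∑-mono-⊆ f [] = z≤n
  ∑-mono-⊆ f (y ∷ʳ s) = ≤-trans (∑-mono-⊆ f s) (m≤n+m _ (f y))
  ∑-mono-⊆ f (refl ∷ s) = +-monoʳ-≤ _ (∑-mono-⊆ f s)

  module Conflicts {X : Set} (R : X → X → Bool) where

    Compatible : X → X → Set
    Compatible x y = R x y ≡ false

    compatible? : ∀ x → Decidable (Compatible x)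
    compatible? x y = R x y BoolP.≟ false

    prune : ∀ {n} → X → Vec (List X) n → Vec (List X) n
    prune x = V.map (filter (compatible? x))

    transversals : ∀ {n} → Vec (List X) n → List (List X)
    transversals [] = [] ∷ []
    transversals (A ∷ As) = concatMap (λ x → map (x ∷_) (transversals (prune x As))) A

    #transversals : ∀ {n} → Vec (List X) n → ℕ
    #transversals As = length (transversals As)

    #transversals-∷ : ∀ {n} (A : List X) (As : Vec (List X) n) →
                      #transversals (A ∷ As) ≡ ∑ A (λ x → #transversals (prune x As))
    #transversals-∷ A As = trans (length-concatMap A _)
                                 (∑-cong A (λ {x} _ → length-map (x ∷_) (transversals (prune x As))))

    prune-⊆ : ∀ {n} x (As : Vec (List X) n) → Sublists (prune x As) As
    prune-⊆ x [] = []
    prune-⊆ x (A ∷ As) = filter-⊆ (compatible? x) A ∷ prune-⊆ x As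

    prune-mono : ∀ {n} x {As Bs : Vec (List X) n} → Sublists As Bs → Sublists (prune x As) (prune x Bs)
    prune-mono x [] = []
    prune-mono x (s ∷ ss) = filter⁺ (compatible? x) (compatible? x) (λ { refl p → p }) s ∷ prune-mono x ss

    #transversals-mono : ∀ {n} {As Bs : Vec (List X) n} → Sublists As Bs → #transversals As ≤ #transversals Bs
    #transversals-mono [] = ≤-refl
    #transversals-mono {As = A ∷ As} {B ∷ Bs} (s ∷ ss) = begin
        #transversals (A ∷ As)                 ≡⟨ #transversals-∷ A As ⟩
        ∑ A (λ x → #transversals (prune x As)) ≤⟨ ∑-mono A (λ {x} _ → #transversals-mono (prune-mono x ss)) ⟩
        ∑ A (λ x → #transversals (prune x Bs)) ≤⟨ ∑-mono-⊆ _ s ⟩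
        ∑ B (λ x → #transversals (prune x Bs)) ≡⟨ sym (#transversals-∷ B Bs) ⟩
        #transversals (B ∷ Bs)                 ∎
      where open ≤-Reasoning

    IsTransversal : ∀ {n} → Vec (List X) n → List X → Set
    IsTransversal [] [] = ⊤
    IsTransversal [] (_ ∷ _) = ⊥
    IsTransversal (A ∷ As) [] = ⊥
    IsTransversal (A ∷ As) (x ∷ t) = x ∈ A × IsTransversal (prune x As) t

    private
      consAll : (X → List (List X)) → List X → List (List X)
      consAll g = concatMap (λ x → map (x ∷_) (g x))

      consAll⁻ : (A : List X) (g : X → List (List X)) {t : List X} → t ∈ consAll g A →
                 ∃ λ x → ∃ λ t′ → t ≡ x ∷ t′ × x ∈ A × t′ ∈ g x
      consAll⁻ (a ∷ A) g t∈ with ∈-++⁻ (map (a ∷_) (g a)) t∈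
      ... | inj₁ p with ∈-map⁻ (a ∷_) p
      ...   | t′ , t′∈ , refl = a , t′ , refl , here refl , t′∈
      consAll⁻ (a ∷ A) g t∈ | inj₂ p with consAll⁻ A g p
      ... | x , t′ , eq , x∈ , t′∈ = x , t′ , eq , there x∈ , t′∈

      consAll⁺ : (A : List X) (g : X → List (List X)) {x : X} {t′ : List X} → x ∈ A → t′ ∈ g x →
                 (x ∷ t′) ∈ consAll g A
      consAll⁺ (a ∷ A) g (here refl) t′∈ = ∈-++⁺ˡ (∈-map⁺ (a ∷_) t′∈)
      consAll⁺ (a ∷ A) g (there x∈) t′∈ = ∈-++⁺ʳ (map (a ∷_) (g a)) (consAll⁺ A g x∈ t′∈)

      consAll-unique : (A : List X) (g : X → List (List X)) → Unique A → (∀ x → Unique (g x)) →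
                       Unique (consAll g A)
      consAll-unique [] g u ug = []
      consAll-unique (a ∷ A) g (a∉A ∷ u) ug =
        UP.++⁺ (UP.map⁺ LP.∷-injectiveʳ (ug a)) (consAll-unique A g u ug) disjoint
        where
        disjoint : ∀ {v} → ¬ (v ∈ map (a ∷_) (g a) × v ∈ consAll g A)
        disjoint (p , q) with ∈-map⁻ (a ∷_) p | consAll⁻ A g q
        ... | _ , _ , refl | x , _ , refl , x∈A , _ = All.lookup a∉A x∈A refl

    transversals-sound : ∀ {n} (As : Vec (List X) n) {t} → t ∈ transversals As → IsTransversal As t
    transversals-sound [] (here refl) = tt
    transversals-sound (A ∷ As) t∈ with consAll⁻ A (λ x → transversals (prune x As)) t∈
    ... | x , t′ , refl , x∈ , t′∈ = x∈ , transversals-sound (prune x As) t′∈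

    transversals-complete : ∀ {n} (As : Vec (List X) n) {t} → IsTransversal As t → t ∈ transversals As
    transversals-complete [] {[]} tt = here refl
    transversals-complete (A ∷ As) {x ∷ t} (x∈ , τ) =
      consAll⁺ A (λ x → transversals (prune x As)) x∈ (transversals-complete (prune x As) τ)

    AllUnique : ∀ {n} → Vec (List X) n → Set
    AllUnique [] = ⊤
    AllUnique (A ∷ As) = Unique A × AllUnique As

    prune-AllUnique : ∀ {n} x (As : Vec (List X) n) → AllUnique As → AllUnique (prune x As)
    prune-AllUnique x [] tt = tt
    prune-AllUnique x (A ∷ As) (u , us) = UP.filter⁺ (compatible? x) u , prune-AllUnique x As us

    transversals-unique : ∀ {n} (As : Vec (List X) n) → AllUnique As → Unique (transversals As)
    transversals-unique [] tt = [] ∷ []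
    transversals-unique (A ∷ As) (u , us) =
      consAll-unique A (λ x → transversals (prune x As)) u
                     (λ x → transversals-unique (prune x As) (prune-AllUnique x As us))

    IsChoice : ∀ {n} → Vec (List X) n → List X → Set
    IsChoice [] [] = ⊤
    IsChoice [] (_ ∷ _) = ⊥
    IsChoice (A ∷ As) [] = ⊥
    IsChoice (A ∷ As) (x ∷ t) = x ∈ A × All (Compatible x) t × IsChoice As t

    choice-unprune : ∀ {n} x (As : Vec (List X) n) t → IsChoice (prune x As) t → All (Compatible x) t × IsChoice As t
    choice-unprune x [] [] tt = [] , tt
    choice-unprune x (B ∷ As) (y ∷ t) (y∈ , cs , c) with choice-unprune x As t c | ∈-filter⁻ (compatible? x) {xs = B} y∈
    ... | cs′ , c′ | y∈B , xy = (xy ∷ cs′) , y∈B , cs , c′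

    choice-prune : ∀ {n} x (As : Vec (List X) n) t → IsChoice As t → All (Compatible x) t → IsChoice (prune x As) t
    choice-prune x [] [] tt [] = tt
    choice-prune x (B ∷ As) (y ∷ t) (y∈ , cs , c) (xy ∷ xt) = ∈-filter⁺ (compatible? x) y∈ xy , cs , choice-prune x As t c xt

    transversal⇒choice : ∀ {n} (As : Vec (List X) n) t → IsTransversal As t → IsChoice As t
    transversal⇒choice [] [] tt = tt
    transversal⇒choice (A ∷ As) (x ∷ t) (x∈ , τ) with choice-unprune x As t (transversal⇒choice (prune x As) t τ)
    ... | cs , c = x∈ , cs , c

    choice⇒transversal : ∀ {n} (As : Vec (List X) n) t → IsChoice As t → IsTransversal As t
    choice⇒transversal [] [] tt = tt
    choice⇒transversal (A ∷ As) (x ∷ t) (x∈ , cs , c) = x∈ , choice⇒transversal (prune x As) t (choice-prune x As t c cs)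

    choice-length : ∀ {n} (As : Vec (List X) n) t → IsChoice As t → length t ≡ n
    choice-length [] [] tt = refl
    choice-length (A ∷ As) (x ∷ t) (_ , _ , c) = cong suc (choice-length As t c)

    choice-compatible : ∀ {n} (As : Vec (List X) n) t → IsChoice As t →
                        ∀ {x y} → x ∈ t → y ∈ t → x ≡ y ⊎ Compatible x y ⊎ Compatible y x
    choice-compatible (A ∷ As) (z ∷ t) _ (here refl) (here refl) = inj₁ refl
    choice-compatible (A ∷ As) (z ∷ t) (_ , cs , _) (here refl) (there y∈) = inj₂ (inj₁ (All.lookup cs y∈))
    choice-compatible (A ∷ As) (z ∷ t) (_ , cs , _) (there x∈) (here refl) = inj₂ (inj₂ (All.lookup cs x∈))
    choice-compatible (A ∷ As) (z ∷ t) (_ , _ , c) (there x∈) (there y∈) = choice-compatible As t c x∈ y∈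

module Chains where

  open Lists
  open Transversals

  -- Starts with the bounds for a single list of size q, one element of which may conflict with the
  -- closing vertex, and iterates (s , lo , e) ↦ ((q-1)s , e , (q-2)s + lo), as in bounds-step.
  chainBounds : ℕ → ℕ → ℕ × ℕ × ℕ
  chainBounds q zero = (q ∸ 1 , 0 , q ∸ 2)
  chainBounds q (suc j) with chainBounds q j
  ... | (s , lo , e) = ((q ∸ 1) * s , e , (q ∸ 2) * s + lo)

  chainTotal chainLeast chainRest : ℕ → ℕ → ℕ
  chainTotal q j = proj₁ (chainBounds q j)
  chainLeast q j = proj₁ (proj₂ (chainBounds q j))
  chainRest q j = proj₂ (proj₂ (chainBounds q j))

  module ChainsOver {X : Set} (_≟_ : DecidableEquality X) (R : X → X → Bool) where
    open Conflicts R public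
    open Removal _≟_ public

    record Bounds (s lo e : ℕ) (L : List X) (h : X → ℕ) : Set where
      field
        total : s ≤ ∑ L h
        each : ∀ {z} → z ∈ L → lo ≤ h z
        rest : ∀ {z0} → z0 ∈ L → e ≤ ∑ (remove z0 L) h

    MatchedInto : X → List X → Set
    MatchedInto z B = ∀ {y y'} → y ∈ B → y' ∈ B → R z y ≡ true → R z y' ≡ true → y ≡ y'

    MatchedInto-⊆ : ∀ {z} {C C' : List X} → C' ⊆ C → MatchedInto z C → MatchedInto z C'
    MatchedInto-⊆ s h a b = h (Sublist.lookup s a) (Sublist.lookup s b)

    MatchedFrom : List X → X → Set
    MatchedFrom L y = ∀ {z z'} → z ∈ L → z' ∈ L → R z y ≡ true → R z' y ≡ true → z ≡ z'

    adjacent? : ∀ z → Decidable (λ y → R z y ≡ true)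
    adjacent? z y = R z y BoolP.≟ true

    prune-≥-rest : ∀ {e lo s} {B : List X} {hB : X → ℕ} (z : X) → Bounds s lo e B hB → MatchedInto z B →
             ∀ {y1} → y1 ∈ B → e ≤ ∑ (filter (compatible? z) B) hB
    prune-≥-rest {e} {B = B} {hB} z inv h1 {y1} y1in with any? (adjacent? z) B
    ... | yes z~B with find z~B
    ...   | y0 , y0∈B , z~y0 = subst (λ M → e ≤ ∑ M hB) (sym feq) (Bounds.rest inv y0∈B)
      where
      feq : filter (compatible? z) B ≡ remove y0 B
      feq = filter-cong (compatible? z) (≢? y0) B
              (λ _ z≁y y≡y0 → BoolP.not-¬ z≁y (subst (λ w → R z w ≡ true) (sym y≡y0) z~y0))
              (λ y∈B y≢y0 → BoolP.¬-not (λ z~y → y≢y0 (h1 y∈B y0∈B z~y z~y0)))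
    prune-≥-rest {e} {B = B} {hB} z inv h1 {y1} y1in | no ¬any = subst (λ M → e ≤ ∑ M hB) (sym feq)
        (≤-trans (Bounds.rest inv y1in) (∑-mono-⊆ hB (remove-⊆ y1 B)))
      where
      feq : filter (compatible? z) B ≡ B
      feq = filter-all (compatible? z) (All.tabulate (λ {y} yin → BoolP.¬-not (λ rt → ¬any (lose yin rt))))

    ∑-prune-split : (z : X) (B : List X) (hB : X → ℕ) →
                ∑ B hB ≡ ∑ (filter (compatible? z) B) hB + ∑ B (λ y → when (R z y) (hB y))
    ∑-prune-split z [] hB = refl
    ∑-prune-split z (y ∷ B) hB with compatible? z y
    ... | yes p rewrite p = trans (cong (hB y +_) (∑-prune-split z B hB)) (sym (+-assoc (hB y) _ _))
    ... | no ¬p rewrite BoolP.¬-not ¬p = trans (cong (hB y +_) (∑-prune-split z B hB))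
        (x∙yz≈y∙xz (hB y) (∑ (filter (compatible? z) B) hB) (∑ B (λ y₁ → when (R z y₁) (hB y₁))))

    unhit-exists : (L′ B : List X) → Unique B → length L′ < length B →
                   (∀ {z} → z ∈ L′ → MatchedInto z B) →
                   ∃ λ y* → y* ∈ B × (∀ {z} → z ∈ L′ → R z y* ≡ false)
    unhit-exists L′ B uB lt matched with all? (λ y → any? (λ z → adjacent? z y) L′) B
    ... | no ¬allHit with find (AllP.¬All⇒Any¬ (λ y → any? (λ z → adjacent? z y) L′) B ¬allHit)
    ...   | y* , y*∈B , unhit = y* , y*∈B , λ z∈ → BoolP.¬-not (λ z~y* → unhit (lose z∈ z~y*))
    unhit-exists L′ B uB lt matched | yes allHit = ⊥-elim (<⇒≱ lt (begin
        length B                                ≡⟨ sym (∑-ones B) ⟩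
        ∑ B (λ _ → 1)                           ≤⟨ ∑-mono B hit ⟩
        ∑ B (λ y → ∑ L′ (λ z → when (R z y) 1)) ≡⟨ sym (∑-swap L′ B (λ z y → when (R z y) 1)) ⟩
        ∑ L′ (λ z → ∑ B (λ y → when (R z y) 1)) ≤⟨ ∑-mono L′ (λ z∈ → ∑-when-≤ (R _) 1 uB (matched z∈)) ⟩
        ∑ L′ (λ _ → 1)                          ≡⟨ ∑-ones L′ ⟩
        length L′                               ∎))
      where
      open ≤-Reasoning
      hit : ∀ {y} → y ∈ B → 1 ≤ ∑ L′ (λ z → when (R z y) 1)
      hit y∈B with find (All.lookup allHit y∈B)
      ... | z , z∈ , z~y = ∑-when-≥ (λ z → R z _) 1 z∈ z~y

    Bounds-cong : ∀ {s lo e L} {f g : X → ℕ} → (∀ {z} → z ∈ L → f z ≡ g z) → Bounds s lo e L f → Bounds s lo e L g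
    Bounds-cong {L = L} f≡g b = record
      { total = subst (_ ≤_) (∑-cong L f≡g) (Bounds.total b)
      ; each = λ z∈ → subst (_ ≤_) (f≡g z∈) (Bounds.each b z∈)
      ; rest = λ z0∈ → subst (_ ≤_) (∑-cong (remove _ L) (f≡g ∘ ∈-remove-⊆ L)) (Bounds.rest b z0∈)
      }

    inhabited : ∀ {k} (B : List X) → length B ≡ suc k → ∃ λ y → y ∈ B
    inhabited (y ∷ B) _ = y , here refl

    module Step {t : ℕ} {L B : List X} (hB : X → ℕ)
                (uL : Unique L) (lenL : length L ≡ 3 + t) (uB : Unique B) (lenB : length B ≡ 3 + t)
                (into : ∀ {z} → z ∈ L → MatchedInto z B) (from : ∀ {y} → y ∈ B → MatchedFrom L y) where

      compatibleSum adjacentSum : X → ℕ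
      compatibleSum z = ∑ (filter (compatible? z) B) hB
      adjacentSum z = ∑ B (λ y → when (R z y) (hB y))

      ∑-adjacentSum : (M : List X) → ∑ M adjacentSum ≡ ∑ B (λ y → ∑ M (λ z → when (R z y) (hB y)))
      ∑-adjacentSum M = ∑-swap M B (λ z y → when (R z y) (hB y))

      ∑-adjacentSum-≤ : ∀ {M} → Unique M → (∀ {z} → z ∈ M → z ∈ L) → ∑ M adjacentSum ≤ ∑ B hB
      ∑-adjacentSum-≤ {M} uM M⊆L = subst (_≤ ∑ B hB) (sym (∑-adjacentSum M))
        (∑-mono B (λ y∈ → ∑-when-≤ (λ z → R z _) _ uM (λ a b → from y∈ (M⊆L a) (M⊆L b))))

      ∑-adjacentSum-avoiding : ∀ {M y*} → Unique M → (∀ {z} → z ∈ M → z ∈ L) → y* ∈ B →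
                               (∀ {z} → z ∈ M → R z y* ≡ false) → ∑ M adjacentSum + hB y* ≤ ∑ B hB
      ∑-adjacentSum-avoiding {M} {y*} uM M⊆L y*∈B unhit = begin
          ∑ M adjacentSum + hB y*     ≤⟨ +-monoˡ-≤ (hB y*) (subst (_≤ ∑ (remove y* B) hB) (sym (∑-adjacentSum M))
                                            (∑-≤-remove-unhit B _ hB y*
                                               (λ y∈ → ∑-when-≤ (λ z → R z _) _ uM (λ a b → from y∈ (M⊆L a) (M⊆L b)))
                                               (∑-when-false (λ z → R z y*) (λ _ → hB y*) unhit))) ⟩
          ∑ (remove y* B) hB + hB y*  ≡⟨ +-comm _ (hB y*) ⟩
          hB y* + ∑ (remove y* B) hB  ≡⟨ sym (∑-remove B hB uB y*∈B) ⟩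
          ∑ B hB                      ∎
        where open ≤-Reasoning

      -- Every z sees all of B either as compatible or as adjacent, so ∑ M compatibleSum = |M| ∑ B hB - ∑ M adjacentSum.
      ∑-compatibleSum-≥ : ∀ {M} k h → (∀ {z} → z ∈ M → z ∈ L) → suc k ≤ length M →
                          ∑ M adjacentSum + h ≤ ∑ B hB → k * ∑ B hB + h ≤ ∑ M compatibleSum
      ∑-compatibleSum-≥ {M} k h M⊆L |M|>k adj≤ = +-cancelˡ-≤ SB _ _ (begin
          SB + (k * SB + h)                   ≡⟨ sym (+-assoc SB (k * SB) h) ⟩
          suc k * SB + h                      ≤⟨ +-monoˡ-≤ h (*-monoˡ-≤ SB |M|>k) ⟩
          length M * SB + h                   ≡⟨ cong (_+ h) (sym partition) ⟩
          ∑ M compatibleSum + ∑ M adjacentSum + h ≡⟨ +-assoc (∑ M compatibleSum) _ h ⟩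
          ∑ M compatibleSum + (∑ M adjacentSum + h) ≤⟨ +-monoʳ-≤ (∑ M compatibleSum) adj≤ ⟩
          ∑ M compatibleSum + SB              ≡⟨ +-comm _ SB ⟩
          SB + ∑ M compatibleSum              ∎)
        where
        open ≤-Reasoning
        SB = ∑ B hB
        partition : ∑ M compatibleSum + ∑ M adjacentSum ≡ length M * SB
        partition = trans (sym (∑-+ M compatibleSum adjacentSum))
                          (trans (∑-cong M (λ z∈ → sym (∑-prune-split _ B hB))) (∑-const M SB))

      unhit-by-remove : ∀ {z0} → z0 ∈ L → ∃ λ y* → y* ∈ B × (∀ {z} → z ∈ remove z0 L → R z y* ≡ false)
      unhit-by-remove {z0} z0∈L with any? (adjacent? z0) B
      ... | yes z0~B with find z0~B
      ...   | y0 , y0∈B , z0~y0 =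
              y0 , y0∈B , λ z∈ → BoolP.¬-not (λ z~y0 → ∈-remove-≢ L z∈ (from y0∈B (∈-remove-⊆ L z∈) z0∈L z~y0 z0~y0))
      unhit-by-remove {z0} z0∈L | no _ =
        unhit-exists (remove z0 L) B uB (subst (length (remove z0 L) <_) (trans lenL (sym lenB)) (length-remove-< z0∈L))
                     (λ z∈ → into (∈-remove-⊆ L z∈))

      bounds-step : ∀ {s lo e} → Bounds s lo e B hB → Bounds ((2 + t) * s) e ((1 + t) * s + lo) L compatibleSum
      bounds-step {s} {lo} {e} bB = record { total = total′ ; each = each′ ; rest = rest′ }
        where
        total′ : (2 + t) * s ≤ ∑ L compatibleSum
        total′ = ≤-trans (*-monoʳ-≤ (2 + t) (Bounds.total bB))
                   (subst (_≤ ∑ L compatibleSum) (+-identityʳ _)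
                     (∑-compatibleSum-≥ (2 + t) 0 (λ z∈ → z∈) (≤-reflexive (sym lenL))
                                        (subst (_≤ ∑ B hB) (sym (+-identityʳ _)) (∑-adjacentSum-≤ uL (λ z∈ → z∈)))))
        each′ : ∀ {z} → z ∈ L → e ≤ compatibleSum z
        each′ z∈ = prune-≥-rest _ bB (into z∈) (proj₂ (inhabited B lenB))
        rest′ : ∀ {z0} → z0 ∈ L → (1 + t) * s + lo ≤ ∑ (remove z0 L) compatibleSum
        rest′ {z0} z0∈L with unhit-by-remove z0∈L
        ... | y* , y*∈B , unhit =
          ≤-trans (+-mono-≤ (*-monoʳ-≤ (1 + t) (Bounds.total bB)) (Bounds.each bB y*∈B))
                  (∑-compatibleSum-≥ (1 + t) (hB y*) (∈-remove-⊆ L)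
                     (≤-pred (subst (_≤ suc (length (remove z0 L))) lenL (length-≤-suc-length-remove z0 uL)))
                     (∑-adjacentSum-avoiding (UP.filter⁺ (≢? z0) uL) (∈-remove-⊆ L) y*∈B unhit))

    open Step public using (bounds-step)

    ChainBounds : ℕ → ℕ → List X → (X → ℕ) → Set
    ChainBounds q j = Bounds (chainTotal q j) (chainLeast q j) (chainRest q j)

    compatibleCount : X → X → ℕ
    compatibleCount x y = when (not (R x y)) 1

    length-compatible : (x : X) (C : List X) → length (filter (compatible? x) C) ≡ ∑ C (compatibleCount x)
    length-compatible x [] = refl
    length-compatible x (y ∷ C) with compatible? x y
    ... | yes p rewrite p = cong suc (length-compatible x C)
    ... | no ¬p rewrite BoolP.¬-not ¬p = length-compatible x C

    filter-comm : {P Q : Pred X 0ℓ} (P? : Decidable P) (Q? : Decidable Q) (xs : List X) →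
                  filter P? (filter Q? xs) ≡ filter Q? (filter P? xs)
    filter-comm P? Q? [] = refl
    filter-comm {P} {Q} P? Q? (x ∷ xs) = go (P? x) (Q? x)
      where
      open LP using (filter-accept; filter-reject)
      go : Dec (P x) → Dec (Q x) → filter P? (filter Q? (x ∷ xs)) ≡ filter Q? (filter P? (x ∷ xs))
      go (yes p) (yes q) rewrite filter-accept Q? {xs = xs} q | filter-accept P? {xs = filter Q? xs} p
                               | filter-accept P? {xs = xs} p | filter-accept Q? {xs = filter P? xs} q
                         = cong (x ∷_) (filter-comm P? Q? xs)
      go (yes p) (no ¬q) rewrite filter-reject Q? {xs = xs} ¬q | filter-accept P? {xs = xs} p
                               | filter-reject Q? {xs = filter P? xs} ¬q = filter-comm P? Q? xs
      go (no ¬p) (yes q) rewrite filter-accept Q? {xs = xs} q | filter-reject P? {xs = filter Q? xs} ¬p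
                               | filter-reject P? {xs = xs} ¬p = filter-comm P? Q? xs
      go (no ¬p) (no ¬q) rewrite filter-reject Q? {xs = xs} ¬q | filter-reject P? {xs = xs} ¬p = filter-comm P? Q? xs

    length-≤-suc-compatible : (x : X) {C : List X} → Unique C → MatchedInto x C →
                              length C ≤ suc (∑ C (compatibleCount x))
    length-≤-suc-compatible x {C} uC x⇉C = subst (λ k → length C ≤ suc k) (length-compatible x C)
      (length-≤-suc-length-filter (compatible? x) uC (λ a b p q → x⇉C a b (BoolP.¬-not p) (BoolP.¬-not q)))

    bounds-base : ∀ {t} (x : X) {L : List X} → Unique L → length L ≡ 3 + t → MatchedInto x L →
                  ChainBounds (3 + t) 0 L (compatibleCount x)
    bounds-base {t} x {L} uL lenL x⇉L = record { total = total′ ; each = λ _ → z≤n ; rest = rest′ }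
      where
      total′ : 2 + t ≤ ∑ L (compatibleCount x)
      total′ = ≤-pred (subst (_≤ suc (∑ L (compatibleCount x))) lenL (length-≤-suc-compatible x uL x⇉L))
      rest′ : ∀ {z0} → z0 ∈ L → 1 + t ≤ ∑ (remove z0 L) (compatibleCount x)
      rest′ {z0} _ = ≤-pred (≤-trans (≤-pred (subst (_≤ suc (length (remove z0 L))) lenL (length-≤-suc-length-remove z0 uL)))
                       (length-≤-suc-compatible x (UP.filter⁺ (≢? z0) uL) (MatchedInto-⊆ (remove-⊆ z0 L) x⇉L)))

    NoConflicts : X → List X → Set
    NoConflicts z C = ∀ {y} → y ∈ C → R z y ≡ false

    NoConflicts* : ∀ {n} → X → Vec (List X) n → Set
    NoConflicts* z [] = ⊤
    NoConflicts* z (C ∷ Cs) = NoConflicts z C × NoConflicts* z Cs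

    Matched : List X → List X → Set
    Matched L B = (∀ {z} → z ∈ L → MatchedInto z B) × (∀ {y} → y ∈ B → MatchedFrom L y)

    Chain : ℕ → ∀ {n} → List X → Vec (List X) n → Set
    Chain t L [] = ⊤
    Chain t L (B ∷ Ps) = Unique B × length B ≡ 3 + t × Matched L B × (∀ {z} → z ∈ L → NoConflicts* z Ps) × Chain t B Ps

    Closes : ∀ {n} → X → Vec (List X) (suc n) → Set
    Closes x (B ∷ []) = MatchedInto x B
    Closes x (B ∷ B' ∷ Ps) = NoConflicts x B × Closes x (B' ∷ Ps)

    chainCount : ∀ {n} → X → Vec (List X) n → X → ℕ
    chainCount x Ps z = #transversals (prune z (prune x Ps))

    #transversals-single : (C : List X) → #transversals (C ∷ []) ≡ length C
    #transversals-single C = trans (#transversals-∷ C []) (∑-ones C)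

    prune-no-conflicts : (z : X) (C : List X) → NoConflicts z C → filter (compatible? z) C ≡ C
    prune-no-conflicts z C nc = filter-all (compatible? z) (All.tabulate nc)

    prune*-no-conflicts : ∀ {n} (z : X) (Cs : Vec (List X) n) → NoConflicts* z Cs → prune z Cs ≡ Cs
    prune*-no-conflicts z [] tt = refl
    prune*-no-conflicts z (C ∷ Cs) (nc , ncs) = cong₂ _∷_ (prune-no-conflicts z C nc) (prune*-no-conflicts z Cs ncs)

    no-conflicts-prune : ∀ {n} (z x : X) (Cs : Vec (List X) n) → NoConflicts* z Cs → NoConflicts* z (prune x Cs)
    no-conflicts-prune z x [] tt = tt
    no-conflicts-prune z x (C ∷ Cs) (nc , ncs) = (λ yin → nc (proj₁ (∈-filter⁻ (compatible? x) {xs = C} yin))) ,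
        no-conflicts-prune z x Cs ncs

    chain-bounds : ∀ {t j} (x : X) (L : List X) (Ps : Vec (List X) (suc j)) →
           Unique L → length L ≡ 3 + t → Chain t L Ps → Closes x Ps →
           ChainBounds (3 + t) (suc j) L (chainCount x Ps)
    chain-bounds {t} {zero} x L (B ∷ []) uL lenL (uB , lenB , (m1 , m2) , _ , _) xok =
      Bounds-cong (λ z∈ → sym (hf z∈)) (bounds-step _ uL lenL uB lenB m1 m2 (bounds-base x uB lenB xok))
      where
      hf : ∀ {z} → z ∈ L → chainCount x (B ∷ []) z ≡ ∑ (filter (compatible? z) B) (compatibleCount x)
      hf {z} _ = trans (#transversals-single (filter (compatible? z) (filter (compatible? x) B)))
          (trans (cong length (filter-comm (compatible? z) (compatible? x) B))
              (length-compatible x (filter (compatible? z) B)))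
    chain-bounds {t} {suc j} x L (B ∷ Ps@(_ ∷ _)) uL lenL (uB , lenB , (m1 , m2) , ncL , good) (ncx , xok) =
      Bounds-cong (λ z∈ → sym (hf z∈)) (bounds-step _ uL lenL uB lenB m1 m2 (chain-bounds x B Ps uB lenB good xok))
      where
      hf : ∀ {z} → z ∈ L → chainCount x (B ∷ Ps) z ≡ ∑ (filter (compatible? z) B) (chainCount x Ps)
      hf {z} zin = begin
          #transversals (filter (compatible? z) (filter (compatible? x) B) ∷ prune z (prune x Ps))
            ≡⟨ cong₂ (λ C Cs → #transversals (filter (compatible? z) C ∷ Cs)) (prune-no-conflicts x B ncx)
                     (prune*-no-conflicts z (prune x Ps) (no-conflicts-prune z x Ps (ncL zin))) ⟩
          #transversals (filter (compatible? z) B ∷ prune x Ps) ≡⟨ #transversals-∷ (filter (compatible? z) B) (prune x Ps) ⟩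
          ∑ (filter (compatible? z) B) (λ y → #transversals (prune y (prune x Ps))) ∎
        where open ≡-Reasoning

    closed-chain-≥ : ∀ {t j} (M0 M1 : List X) (Ps : Vec (List X) (suc j)) →
               Unique M0 → length M0 ≡ 3 + t → Unique M1 → length M1 ≡ 3 + t →
               Chain t M1 Ps → (∀ {x} → x ∈ M0 → MatchedInto x M1 × Closes x Ps) →
               (3 + t) * chainRest (3 + t) (suc j) ≤ #transversals (M0 ∷ M1 ∷ Ps)
    closed-chain-≥ {t} {j} M0 M1 Ps u0 len0 u1 len1 good hx = begin
        (3 + t) * chainRest (3 + t) (suc j) ≡⟨ cong (_* chainRest (3 + t) (suc j)) (sym len0) ⟩
        length M0 * chainRest (3 + t) (suc j) ≤⟨ ∑-≥ M0 (chainRest (3 + t) (suc j)) per ⟩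
        ∑ M0 (λ x → #transversals (prune x (M1 ∷ Ps))) ≡⟨ sym (#transversals-∷ M0 (M1 ∷ Ps)) ⟩
        #transversals (M0 ∷ M1 ∷ Ps) ∎
      where
      open ≤-Reasoning
      per : ∀ {x} → x ∈ M0 → chainRest (3 + t) (suc j) ≤ #transversals (prune x (M1 ∷ Ps))
      per {x} xin with hx xin
      ... | h1 , xok = subst (chainRest (3 + t) (suc j) ≤_) (sym (#transversals-∷ (filter (compatible? x) M1) (prune x Ps)))
                               (prune-≥-rest x (chain-bounds x M1 Ps u1 len1 good xok) h1 (proj₂ (inhabited M1 len1)))

module Cycles where

  open Lists
  open Transversals
  open Chains

  CycleAdjacent : ℕ → ℕ → ℕ → Set
  CycleAdjacent n a b = (suc a ≡ b) ⊎ (suc b ≡ a) ⊎ (a ≡ 0 × suc b ≡ n) ⊎ (b ≡ 0 × suc a ≡ n)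

  non-adjacent-apart : ∀ {n i l} → 1 ≤ i → suc (suc i) ≤ l → ¬ CycleAdjacent n i l
  non-adjacent-apart i≥1 le (inj₁ refl) = 1+n≰n le
  non-adjacent-apart {i = i} {l} i≥1 le (inj₂ (inj₁ refl)) = 1+n≰n (≤-trans (n≤1+n _) (≤-trans (n≤1+n _) le))
  non-adjacent-apart i≥1 le (inj₂ (inj₂ (inj₁ (refl , _)))) = 1+n≰n i≥1
  non-adjacent-apart i≥1 le (inj₂ (inj₂ (inj₂ (refl , _)))) = 1+n≰n (≤-trans (s≤s z≤n) le)

  non-adjacent-from-0 : ∀ {n l} → 2 ≤ l → suc (suc l) ≤ n → ¬ CycleAdjacent n 0 l
  non-adjacent-from-0 l≥2 le (inj₁ refl) = 1+n≰n l≥2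
  non-adjacent-from-0 l≥2 le (inj₂ (inj₁ ()))
  non-adjacent-from-0 {l = l} l≥2 le (inj₂ (inj₂ (inj₁ (_ , e)))) = 1+n≰n (≤-trans le (≤-reflexive (sym e)))
  non-adjacent-from-0 l≥2 le (inj₂ (inj₂ (inj₂ (refl , _)))) = 1+n≰n (≤-trans (s≤s z≤n) l≥2)

  module CycleCover {X : Set} (_≟_ : DecidableEquality X) (R : X → X → Bool)
              (R-sym : ∀ z y → R z y ≡ R y z)
              (OnCycle : X → Set) (position : X → ℕ) (n : ℕ)
              (adjacent-positions : ∀ {z y} → OnCycle z → OnCycle y → R z y ≡ true → position z ≡ position y ⊎ CycleAdjacent n
                  (position z) (position y))
              (matching : ∀ {z y y'} → OnCycle z → OnCycle y → OnCycle y' → position y ≡ position y' →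
                  ¬ position z ≡ position y →
                     R z y ≡ true → R z y' ≡ true → y ≡ y') where
    open ChainsOver _≟_ R

    AtPosition : ℕ → List X → Set
    AtPosition i C = ∀ {z} → z ∈ C → OnCycle z × position z ≡ i

    AtPositions : ℕ → ∀ {k} → Vec (List X) k → Set
    AtPositions i [] = ⊤
    AtPositions i (C ∷ Cs) = AtPosition i C × AtPositions (suc i) Cs

    UniqueOfLength : ℕ → ∀ {k} → Vec (List X) k → Set
    UniqueOfLength q [] = ⊤
    UniqueOfLength q (C ∷ Cs) = Unique C × length C ≡ q × UniqueOfLength q Cs

    consecutive-matched : ∀ {i L B} → AtPosition i L → AtPosition (suc i) B → Matched L B
    consecutive-matched {i} pl pb = (λ zin yin y'in r r' → matching (proj₁ (pl zin)) (proj₁ (pb yin)) (proj₁ (pb y'in))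
                                                (trans (proj₂ (pb yin)) (sym (proj₂ (pb y'in))))
                                                (λ e → 1+n≢n (sym (trans (sym (proj₂ (pl zin)))
                                                    (trans e (proj₂ (pb yin)))))) r r') ,
                      (λ yin zin z'in r r' → matching (proj₁ (pb yin)) (proj₁ (pl zin)) (proj₁ (pl z'in))
                                                (trans (proj₂ (pl zin)) (sym (proj₂ (pl z'in))))
                                                (λ e → 1+n≢n (sym (trans (sym (proj₂ (pl zin)))
                                                    (trans (sym e) (proj₂ (pb yin))))))
                                                (trans (R-sym _ _) r) (trans (R-sym _ _) r'))

    distant-not-adjacent : ∀ {i l} → 1 ≤ i → suc (suc i) ≤ l → i ≡ l ⊎ CycleAdjacent n i l → ⊥
    distant-not-adjacent i≥1 le (inj₁ refl) = 1+n≰n (≤-trans (n≤1+n _) le)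
    distant-not-adjacent i≥1 le (inj₂ c) = non-adjacent-apart i≥1 le c

    distant-compatible : ∀ {i l z y} → 1 ≤ i → suc (suc i) ≤ l → OnCycle z → OnCycle y → position z ≡ i →
        position y ≡ l → R z y ≡ false
    distant-compatible {i} {l} {z} {y} i≥1 le cz cy pz py with R z y in eq
    ... | false = refl
    ... | true = ⊥-elim (distant-not-adjacent i≥1 le
        (subst₂ (λ a b → a ≡ b ⊎ CycleAdjacent n a b) pz py (adjacent-positions cz cy eq)))

    distant-no-conflicts : ∀ {i l k} {z} (Cs : Vec (List X) k) → 1 ≤ i → suc (suc i) ≤ l → OnCycle z → position z ≡ i →
        AtPositions l Cs → NoConflicts* z Cs
    distant-no-conflicts [] _ _ _ _ tt = tt
    distant-no-conflicts (C ∷ Cs) i≥1 le cz pz (pc , pcs) =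
        (λ yin → distant-compatible i≥1 le cz (proj₁ (pc yin)) pz (proj₂ (pc yin))) ,
                                                distant-no-conflicts Cs i≥1 (≤-trans le (n≤1+n _)) cz pz pcs

    positions-chain : ∀ {t i k} (L : List X) (Ps : Vec (List X) k) → 1 ≤ i → AtPosition i L → AtPositions (suc i) Ps →
        UniqueOfLength (3 + t) Ps → Chain t L Ps
    positions-chain L [] _ _ _ _ = tt
    positions-chain {t} {i} L (B ∷ Ps) i≥1 pl (pb , pps) (uB , lB , ul) =
      uB , lB , consecutive-matched pl pb ,
          (λ zin → distant-no-conflicts Ps i≥1 ≤-refl (proj₁ (pl zin)) (proj₂ (pl zin)) pps) ,
      positions-chain B Ps (≤-trans i≥1 (n≤1+n i)) pb pps ul

    positions-close : ∀ {k i} {x} (Ps : Vec (List X) (suc k)) → 2 ≤ i → suc k + i ≡ n → OnCycle x → position x ≡ 0 →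
        AtPositions i Ps → Closes x Ps
    positions-close {zero} {i} {x} (B ∷ []) i≥2 eqn cx px (pb , _) =
      λ yin y'in r r' → matching cx (proj₁ (pb yin)) (proj₁ (pb y'in)) (trans (proj₂ (pb yin)) (sym (proj₂ (pb y'in))))
                            (λ e → 0≢1+n (trans (sym px) (trans e (trans (proj₂ (pb yin)) (lem i≥2))))) r r'
      where
      lem : ∀ {i} → 2 ≤ i → i ≡ suc (pred i)
      lem (s≤s _) = refl
    positions-close {suc k} {i} {x} (B ∷ Ps@(_ ∷ _)) i≥2 eqn cx px (pb , pps) =
      (λ {y} yin → nc yin) , positions-close Ps (≤-trans i≥2 (n≤1+n i)) (trans (+-suc (suc k) i) eqn) cx px pps
      where
      nc' : ∀ {l} → 2 ≤ l → suc (suc k) + l ≡ n → 0 ≡ l ⊎ CycleAdjacent n 0 l → ⊥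
      nc' l≥2 en (inj₁ refl) = 1+n≰n (≤-trans (s≤s z≤n) l≥2)
      nc' {l} l≥2 en (inj₂ c) = non-adjacent-from-0 l≥2 (≤-trans (s≤s (s≤s (m≤n+m l k))) (≤-reflexive en)) c
      nc : ∀ {y} → y ∈ B → R x y ≡ false
      nc {y} yin with R x y in eq
      ... | false = refl
      ... | true = ⊥-elim (nc' i≥2 eqn
          (subst₂ (λ a b → a ≡ b ⊎ CycleAdjacent n a b) px (proj₂ (pb yin)) (adjacent-positions cx (proj₁ (pb yin)) eq)))

    cycle-≥ : ∀ {t k} (Cs : Vec (List X) (3 + k)) → 3 + k ≡ n → AtPositions 0 Cs → UniqueOfLength (3 + t) Cs →
            (3 + t) * chainRest (3 + t) (suc k) ≤ #transversals Cs
    cycle-≥ {t} {k} (M0 ∷ M1 ∷ Ps) eqn (p0 , p1 , pps) (u0 , l0 , u1 , l1 , ul) =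
      closed-chain-≥ M0 M1 Ps u0 l0 u1 l1 (positions-chain M1 Ps ≤-refl p1 pps ul) hx
      where
      hx : ∀ {x} → x ∈ M0 → MatchedInto x M1 × Closes x Ps
      hx xin = (λ yin y'in r r' → matching (proj₁ (p0 xin)) (proj₁ (p1 yin)) (proj₁ (p1 y'in))
                                     (trans (proj₂ (p1 yin)) (sym (proj₂ (p1 y'in))))
                                     (λ e → 0≢1+n (trans (sym (proj₂ (p0 xin))) (trans e (proj₂ (p1 yin))))) r r') ,
               positions-close Ps ≤-refl (trans (+-comm (suc k) 2) eqn) (proj₁ (p0 xin)) (proj₂ (p0 xin)) pps

    AtPosition-⊆ : ∀ {i} {C C' : List X} → C' ⊆ C → AtPosition i C → AtPosition i C'
    AtPosition-⊆ s pl zin = pl (Sublist.lookup s zin)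

    AtPositions-Sublists : ∀ {i k} {Cs Cs' : Vec (List X) k} → Sublists Cs' Cs → AtPositions i Cs → AtPositions i Cs'
    AtPositions-Sublists [] tt = tt
    AtPositions-Sublists (s ∷ ss) (pl , pv) = AtPosition-⊆ s pl , AtPositions-Sublists ss pv

module CliquePeeling where

  open Lists
  open Transversals
  open Chains

  falling : ℕ → ℕ → ℕ
  falling m zero = 1
  falling m (suc j) = m * falling (m ∸ 1) j

  module Peeling {X : Set} (_≟_ : DecidableEquality X) (R : X → X → Bool) where
    open ChainsOver _≟_ R

    UniqueAtLeast : ℕ → ∀ {k} → Vec (List X) k → Set
    UniqueAtLeast q [] = ⊤
    UniqueAtLeast q (C ∷ Cs) = Unique C × q ≤ length C × UniqueAtLeast q Cs

    MatchedInto* : X → ∀ {k} → Vec (List X) k → Set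
    MatchedInto* z [] = ⊤
    MatchedInto* z (C ∷ Cs) = MatchedInto z C × MatchedInto* z Cs

    CliqueMatched : ∀ {j k} → Vec (List X) j → Vec (List X) k → Set
    CliqueMatched [] Cs = ⊤
    CliqueMatched (A ∷ Ks) Cs = (∀ {z} → z ∈ A → MatchedInto* z (Ks V.++ Cs)) × CliqueMatched Ks Cs

    CycleBounded : ℕ → ℕ → ∀ {k} → Vec (List X) k → Set
    CycleBounded q b Cs = ∀ Cs' → Sublists Cs' Cs → UniqueAtLeast q Cs' → b ≤ #transversals Cs'

    MatchedInto*-prune : ∀ {k z} x (Cs : Vec (List X) k) → MatchedInto* z Cs → MatchedInto* z (prune x Cs)
    MatchedInto*-prune x [] tt = tt
    MatchedInto*-prune x (C ∷ Cs) (h , hs) = MatchedInto-⊆ (filter-⊆ (compatible? x) C) h , MatchedInto*-prune x Cs hs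

    CliqueMatched-prune : ∀ {j k} x (Ks : Vec (List X) j) (Cs : Vec (List X) k) →
                          CliqueMatched Ks Cs → CliqueMatched (prune x Ks) (prune x Cs)
    CliqueMatched-prune x [] Cs tt = tt
    CliqueMatched-prune x (A ∷ Ks) Cs (h , hs) =
      (λ zin → subst (MatchedInto* _) (VP.map-++ (filter (compatible? x)) Ks Cs)
                 (MatchedInto*-prune x (Ks V.++ Cs) (h (proj₁ (∈-filter⁻ (compatible? x) {xs = A} zin))))) ,
      CliqueMatched-prune x Ks Cs hs

    UniqueAtLeast-prune : ∀ {k q} x (Cs : Vec (List X) k) → MatchedInto* x Cs → UniqueAtLeast (suc q) Cs →
        UniqueAtLeast q (prune x Cs)
    UniqueAtLeast-prune x [] tt tt = tt
    UniqueAtLeast-prune {q = q} x (C ∷ Cs) (h , hs) (u , l , ls) =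
      UP.filter⁺ (compatible? x) u ,
      ≤-pred (≤-trans l (length-≤-suc-length-filter (compatible? x) u
          (λ a b p p' → h a b (BoolP.¬-not p) (BoolP.¬-not p')))) ,
      UniqueAtLeast-prune x Cs hs ls

    peel-≥ : ∀ {j k} (m : ℕ) (Ks : Vec (List X) j) (Cs : Vec (List X) k) (b : ℕ) →
             UniqueAtLeast m Ks → UniqueAtLeast m Cs → CliqueMatched Ks Cs → CycleBounded (m ∸ j) b Cs →
             falling m j * b ≤ #transversals (Ks V.++ Cs)
    peel-≥ m [] Cs b _ lc _ bounded = subst (_≤ #transversals Cs) (sym (+-identityʳ b))
        (bounded Cs (Pointwise.refl ⊆-refl) lc)
    peel-≥ zero (A ∷ Ks) Cs b _ _ _ _ = z≤n
    peel-≥ {suc j} (suc m) (A ∷ Ks) Cs b (uA , lA , lks) lc (hA , kok) bounded = begin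
        suc m * falling m j * b ≡⟨ *-assoc (suc m) (falling m j) b ⟩
        suc m * (falling m j * b) ≤⟨ *-monoˡ-≤ (falling m j * b) lA ⟩
        length A * (falling m j * b) ≤⟨ ∑-≥ A (falling m j * b) per ⟩
        ∑ A (λ x → #transversals (prune x (Ks V.++ Cs))) ≡⟨ sym (#transversals-∷ A (Ks V.++ Cs)) ⟩
        #transversals (A ∷ Ks V.++ Cs) ∎
      where
      open ≤-Reasoning
      split : ∀ {x} → MatchedInto* x (Ks V.++ Cs) → MatchedInto* x Ks × MatchedInto* x Cs
      split = go Ks
        where
        go : ∀ {j'} {x} (Ks' : Vec (List X) j') → MatchedInto* x (Ks' V.++ Cs) → MatchedInto* x Ks' × MatchedInto* x Cs
        go [] h = tt , h
        go (K ∷ Ks') (h , hs) = (h , proj₁ (go Ks' hs)) , proj₂ (go Ks' hs)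
      per : ∀ {x} → x ∈ A → falling m j * b ≤ #transversals (prune x (Ks V.++ Cs))
      per {x} xin = subst (λ V → falling m j * b ≤ #transversals V) (sym (VP.map-++ (filter (compatible? x)) Ks Cs))
                      (peel-≥ m (prune x Ks) (prune x Cs) b
                         (UniqueAtLeast-prune x Ks (proj₁ (split (hA xin))) lks)
                         (UniqueAtLeast-prune x Cs (proj₂ (split (hA xin))) lc)
                         (CliqueMatched-prune x Ks Cs kok)
                         (λ Cs' sub lu → bounded Cs' (Pointwise.trans ⊆-trans sub (prune-⊆ x Cs)) lu))

module CycleBound where

  open Lists
  open Transversals
  open Chains
  open Cycles
  open CliquePeeling

  cycleCount : ℕ → ℕ → ℕ
  cycleCount q k = q * chainRest q (suc k)

  chainBounds-≤2 : ∀ q j → q ≤ 2 → chainLeast q j ≡ 0 × chainRest q j ≡ 0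
  chainBounds-≤2 q zero le = refl , m≤n⇒m∸n≡0 le
  chainBounds-≤2 0 (suc j) le = proj₂ (chainBounds-≤2 0 j le) , proj₁ (chainBounds-≤2 0 j le)
  chainBounds-≤2 1 (suc j) le = proj₂ (chainBounds-≤2 1 j le) , proj₁ (chainBounds-≤2 1 j le)
  chainBounds-≤2 2 (suc j) le = proj₂ (chainBounds-≤2 2 j le) , proj₁ (chainBounds-≤2 2 j le)
  chainBounds-≤2 (suc (suc (suc q))) (suc j) (s≤s (s≤s ()))

  cycleCount-≤2 : ∀ q k → q ≤ 2 → cycleCount q k ≡ 0
  cycleCount-≤2 q k le = trans (cong (q *_) (proj₂ (chainBounds-≤2 q (suc k) le))) (*-zeroʳ q)

  module CycleCoverBound {X : Set} (_≟_ : DecidableEquality X) (R : X → X → Bool)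
              (R-sym : ∀ z y → R z y ≡ R y z)
              (OnCycle : X → Set) (position : X → ℕ) (n : ℕ)
              (adjacent-positions : ∀ {z y} → OnCycle z → OnCycle y → R z y ≡ true → position z ≡ position y ⊎ CycleAdjacent n
                  (position z) (position y))
              (matching : ∀ {z y y'} → OnCycle z → OnCycle y → OnCycle y' → position y ≡ position y' →
                  ¬ position z ≡ position y →
                     R z y ≡ true → R z y' ≡ true → y ≡ y') where
    open ChainsOver _≟_ R
    open CycleCover _≟_ R R-sym OnCycle position n adjacent-positions matching
    open Peeling _≟_ R

    restrict : ∀ {k} q (Cs : Vec (List X) k) → UniqueAtLeast q Cs → UniqueOfLength q
        (V.map (take q) Cs) × Sublists (V.map (take q) Cs) Cs
    restrict q [] tt = tt , []
    restrict q (C ∷ Cs) (u , l , ls) =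
      (UP.take⁺ q u , trans (LP.length-take q C) (m≤n⇒m⊓n≡m l) , proj₁ (restrict q Cs ls)) ,
          (take-⊆ q C ∷ proj₂ (restrict q Cs ls))

    cycle-bounded : ∀ {k} (Cs : Vec (List X) (3 + k)) → 3 + k ≡ n → AtPositions 0 Cs → ∀ q →
        CycleBounded q (cycleCount q k) Cs
    cycle-bounded {k} Cs eqn pv q Cs' sub lu with q ≤? 2
    ... | yes le = subst (_≤ #transversals Cs') (sym (cycleCount-≤2 q k le)) z≤n
    ... | no gt = go q (≰⇒> gt) lu
      where
      go : ∀ q' → 2 < q' → UniqueAtLeast q' Cs' → cycleCount q' k ≤ #transversals Cs'
      go (suc zero) (s≤s ()) _
      go (suc (suc zero)) (s≤s (s≤s ())) _
      go (suc (suc (suc t))) _ lu' =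
        ≤-trans (cycle-≥ (V.map (take (3 + t)) Cs') eqn
                   (AtPositions-Sublists (Pointwise.trans ⊆-trans (proj₂ (restrict (3 + t) Cs' lu')) sub) pv)
                   (proj₁ (restrict (3 + t) Cs' lu')))
                (#transversals-mono (proj₂ (restrict (3 + t) Cs' lu')))

module ClosedForm where

  open Chains using (chainTotal; chainLeast; chainRest)

  -- Numbers of proper colourings of a path in 2 + t colours that start with a given colour and end
  -- with a colour other than c0, for start colour c0, resp. different from c0. They attain the
  -- bounds of chainBounds, the two roles alternating with the parity of the length.
  closedForm : ℕ → ℕ → ℕ × ℕ
  closedForm t zero = (0 , 1)
  closedForm t (suc j) = ((1 + t) * proj₂ (closedForm t j) , proj₁ (closedForm t j) + t * proj₂ (closedForm t j))

  sameColour otherColour : ℕ → ℕ → ℕ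
  sameColour t j = proj₁ (closedForm t j)
  otherColour t j = proj₂ (closedForm t j)

  even : ℕ → Bool
  even zero = true
  even (suc j) = not (even j)

  ClosedFormCase : Bool → ℕ → ℕ → Set
  ClosedFormCase true t j = sameColour t j ≡ chainLeast (2 + t) j × otherColour t j ≡ suc (chainLeast (2 + t) j) × chainRest
      (2 + t) j ≡ sameColour t j + t * otherColour t j
  ClosedFormCase false t j = otherColour t j ≡ chainLeast (2 + t) j × sameColour t j ≡ suc (chainLeast (2 + t) j) × chainRest
      (2 + t) j ≡ (1 + t) * otherColour t j

  private
    open +-*-Solver

    r1 : ∀ t C D → (1 + t) * (C + (1 + t) * D) ≡ (1 + t) * D + (1 + t) * (C + t * D)
    r1 = solve 3 (λ t C D → (con 1 :+ t) :* (C :+ (con 1 :+ t) :* D) := (con 1 :+ t) :* D :+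
        (con 1 :+ t) :* (C :+ t :* D)) refl

    r2 : ∀ t C → (1 + t) * suc C ≡ suc (C + t * suc C)
    r2 = solve 2 (λ t C → (con 1 :+ t) :* (con 1 :+ C) := con 1 :+ (C :+ t :* (con 1 :+ C))) refl

    r3 : ∀ t C D → t * (C + (1 + t) * D) + C ≡ (1 + t) * (C + t * D)
    r3 = solve 3 (λ t C D → t :* (C :+ (con 1 :+ t) :* D) :+ C := (con 1 :+ t) :* (C :+ t :* D)) refl

    r4 : ∀ t D → suc D + t * D ≡ suc ((1 + t) * D)
    r4 = solve 2 (λ t D → (con 1 :+ D) :+ t :* D := con 1 :+ (con 1 :+ t) :* D) refl

    r5 : ∀ t C D → t * (C + (1 + t) * D) + D ≡ (1 + t) * D + t * (C + t * D)
    r5 = solve 3 (λ t C D → t :* (C :+ (con 1 :+ t) :* D) :+ D := (con 1 :+ t) :* D :+ t :* (C :+ t :* D)) refl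

  chainBounds-closedForm : ∀ t j → chainTotal (2 + t) j ≡ sameColour t j +
      (1 + t) * otherColour t j × ClosedFormCase (even j) t j
  chainBounds-closedForm t zero = sym (*-identityʳ (1 + t)) , refl , refl , sym (*-identityʳ t)
  chainBounds-closedForm t (suc j) with even j | chainBounds-closedForm t j
  ... | true | (eS , eC , eD , eE) =
    trans (cong ((1 + t) *_) eS) (r1 t (sameColour t j) (otherColour t j)) ,
    sym eE ,
    trans (cong ((1 + t) *_) eD) (trans (r2 t (chainLeast (2 + t) j))
        (cong suc (trans (cong₂ (λ a b → a + t * b) (sym eC) (sym eD)) (sym eE)))) ,
    trans (cong₂ (λ a b → t * a + b) eS (sym eC)) (r3 t (sameColour t j) (otherColour t j))
  ... | false | (eS , eD , eC , eE) =
    trans (cong ((1 + t) *_) eS) (r1 t (sameColour t j) (otherColour t j)) ,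
    sym eE ,
    trans (cong (λ a → a + t * otherColour t j) eC)
        (trans (cong (λ a → suc a + t * otherColour t j) (sym eD)) (trans (r4 t (otherColour t j)) (cong suc (sym eE)))) ,
    trans (cong₂ (λ a b → t * a + b) eS (sym eD)) (r5 t (sameColour t j) (otherColour t j))

module CanonicalCount where

  open Lists
  open Transversals
  open Chains
  open Cycles using (CycleAdjacent; non-adjacent-apart; non-adjacent-from-0)
  open CliquePeeling using (falling)
  open CycleBound using (cycleCount)
  open ClosedForm

  upFrom : ℕ → (k : ℕ) → Vec ℕ k
  upFrom i zero = []
  upFrom i (suc k) = i ∷ upFrom (suc i) k

  module ProductCover {X : Set} (_≟_ : DecidableEquality X) (R : X → X → Bool)
                {Vt Col : Set} (_≟c_ : DecidableEquality Col) (mk : Vt → Col → X) (A : Vt → Vt → Bool)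
                (R-mk : ∀ u v a b → ¬ u ≡ v → R (mk u a) (mk v b) ≡ (A u v ∧ ⌊ a ≟c b ⌋))
                (Airr : ∀ u → A u u ≡ false) where
    open ChainsOver _≟_ R
    module PC = Removal _≟c_
    removeColour = PC.remove

    fibre : List Col → Vt → List X
    fibre Q v = map (mk v) Q

    A-ne : ∀ {u v} → A u v ≡ true → ¬ u ≡ v
    A-ne {u} e refl = BoolP.not-¬ (Airr u) e

    prune-fibre-adjacent : ∀ {u v} a (Q : List Col) → A u v ≡ true →
                           filter (compatible? (mk u a)) (fibre Q v) ≡ fibre (removeColour a Q) v
    prune-fibre-adjacent a [] e = refl
    prune-fibre-adjacent {u} {v} a (b ∷ Q) e with b ≟c a
    ... | yes refl = trans (LP.filter-reject (compatible? (mk u a)) (BoolP.not-¬ conflict)) (prune-fibre-adjacent a Q e)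
      where
      conflict : R (mk u a) (mk v a) ≡ true
      conflict = trans (R-mk u v a a (A-ne e)) (cong₂ _∧_ e (trans (isYes≗does (a ≟c a)) (dec-true (a ≟c a) refl)))
    ... | no b≢a = trans (LP.filter-accept (compatible? (mk u a)) compatible) (cong (mk v b ∷_) (prune-fibre-adjacent a Q e))
      where
      compatible : R (mk u a) (mk v b) ≡ false
      compatible = trans (R-mk u v a b (A-ne e)) (cong₂ _∧_ e (trans (isYes≗does (a ≟c b)) (dec-false (a ≟c b) (b≢a ∘ sym))))

    no-conflicts-nonadjacent : ∀ {u v} a (Q : List Col) → A u v ≡ false → ¬ u ≡ v → NoConflicts (mk u a) (fibre Q v)
    no-conflicts-nonadjacent {u} {v} a Q e ne {y} yin with ∈-map⁻ (mk v) yin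
    ... | b , _ , refl = trans (R-mk u v a b ne) (cong (_∧ ⌊ a ≟c b ⌋) e)

    length-removeColour : ∀ {r} {a} {Q : List Col} → Unique Q → a ∈ Q → length Q ≡ suc r → length (removeColour a Q) ≡ r
    length-removeColour {r} {a} {Q} u ain eq = ≤-antisym
        (≤-pred (subst (length (removeColour a Q) <_) eq (PC.length-remove-< ain)))
                                           (≤-pred (subst (_≤ suc (length (removeColour a Q))) eq
                                               (PC.length-≤-suc-length-remove a u)))

    ∈-removeColour : ∀ {a b} {Q : List Col} → b ∈ Q → ¬ b ≡ a → b ∈ removeColour a Q
    ∈-removeColour {a} bin ne = ∈-filter⁺ (PC.≢? a) bin ne

    AdjacentToAll : Vt → ∀ {k} → Vec Vt k → Set
    AdjacentToAll u [] = ⊤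
    AdjacentToAll u (v ∷ vs) = A u v ≡ true × AdjacentToAll u vs

    CliqueBefore : ∀ {j k} → Vec Vt j → Vec Vt k → Set
    CliqueBefore [] ws = ⊤
    CliqueBefore (u ∷ us) ws = AdjacentToAll u (us V.++ ws) × CliqueBefore us ws

    prune-fibres : ∀ {k} (u : Vt) a (Q : List Col) (vs : Vec Vt k) → AdjacentToAll u vs →
             prune (mk u a) (V.map (fibre Q) vs) ≡ V.map (fibre (removeColour a Q)) vs
    prune-fibres u a Q [] tt = refl
    prune-fibres u a Q (v ∷ vs) (e , es) = cong₂ _∷_ (prune-fibre-adjacent a Q e) (prune-fibres u a Q vs es)

    peel-≤ : ∀ {j k} (m' : ℕ) (Q : List Col) → Unique Q → length Q ≡ m' →
             (us : Vec Vt j) (ws : Vec Vt k) → CliqueBefore us ws → (b : ℕ) →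
             (∀ Q' → Unique Q' → length Q' ≡ m' ∸ j → #transversals (V.map (fibre Q') ws) ≤ b) →
             #transversals (V.map (fibre Q) (us V.++ ws)) ≤ falling m' j * b
    peel-≤ m' Q u l [] ws tt b fibres-cycle-≤ = subst (#transversals (V.map (fibre Q) ws) ≤_)
        (sym (+-identityʳ b)) (fibres-cycle-≤ Q u l)
    peel-≤ zero [] u l (u₀ ∷ us) ws _ b fibres-cycle-≤ = z≤n
    peel-≤ {suc j} (suc m) Q u l (u₀ ∷ us) ws (adj , adjs) b fibres-cycle-≤ = begin
        #transversals (fibre Q u₀ ∷ V.map (fibre Q) (us V.++ ws)) ≡⟨ #transversals-∷ (fibre Q u₀)
            (V.map (fibre Q) (us V.++ ws)) ⟩
        ∑ (map (mk u₀) Q) (λ x → #transversals (prune x (V.map (fibre Q) (us V.++ ws)))) ≡⟨ ∑-map Q (mk u₀)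
            (λ x → #transversals (prune x (V.map (fibre Q) (us V.++ ws)))) ⟩
        ∑ Q (λ a → #transversals (prune (mk u₀ a) (V.map (fibre Q) (us V.++ ws)))) ≤⟨ ∑-≤ Q (falling m j * b) per ⟩
        length Q * (falling m j * b) ≡⟨ cong (_* (falling m j * b)) l ⟩
        suc m * (falling m j * b) ≡⟨ sym (*-assoc (suc m) (falling m j) b) ⟩
        suc m * falling m j * b ∎
      where
      open ≤-Reasoning
      per : ∀ {a} → a ∈ Q → #transversals (prune (mk u₀ a) (V.map (fibre Q) (us V.++ ws))) ≤ falling m j * b
      per {a} ain = subst (_≤ falling m j * b) (cong #transversals (sym (prune-fibres u₀ a Q (us V.++ ws) adj)))
                      (peel-≤ m (removeColour a Q) (UP.filter⁺ (PC.≢? a) u)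
                          (length-removeColour u ain l) us ws adjs b fibres-cycle-≤)

    module CanonicalCycle (cv : ℕ → Vt) (n : ℕ)
                (adjacent⇒A : ∀ {i l} → i < n → l < n → CycleAdjacent n i l → A (cv i) (cv l) ≡ true)
                (A⇒adjacent : ∀ {i l} → i < n → l < n → A (cv i) (cv l) ≡ true → CycleAdjacent n i l)
                (cvinj : ∀ {i l} → i < n → l < n → cv i ≡ cv l → i ≡ l) where

      cycleFibres : List Col → ℕ → (k : ℕ) → Vec (List X) k
      cycleFibres Q i k = V.map (fibre Q ∘ cv) (upFrom i k)

      pathValue : ℕ → ℕ → Col → Col → ℕ
      pathValue t j c0 a = if ⌊ a ≟c c0 ⌋ then sameColour t j else otherColour t j

      pathValue-≢ : ∀ {t j c0 a} → ¬ a ≡ c0 → pathValue t j c0 a ≡ otherColour t j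
      pathValue-≢ {c0 = c0} {a} ne with a ≟c c0
      ... | yes e = ⊥-elim (ne e)
      ... | no _ = refl

      pathValue-≡ : ∀ {t j c0} → pathValue t j c0 c0 ≡ sameColour t j
      pathValue-≡ {c0 = c0} with c0 ≟c c0
      ... | yes _ = refl
      ... | no ne = ⊥-elim (ne refl)

      ∑-pathValue : ∀ {t j c0 a} {Q : List Col} → Unique Q → length Q ≡ 2 + t → c0 ∈ Q → a ∈ Q →
               ∑ (removeColour a Q) (pathValue t j c0) ≡ pathValue t (suc j) c0 a
      ∑-pathValue {t} {j} {c0} {a} {Q} u l c0in ain with a ≟c c0
      ... | yes refl = begin
          ∑ (removeColour a Q) (pathValue t j a) ≡⟨ ∑-cong (removeColour a Q)
              (λ bin → pathValue-≢ {t} {j} {a} (proj₂ (∈-filter⁻ (PC.≢? a) {xs = Q} bin))) ⟩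
          ∑ (removeColour a Q) (λ _ → otherColour t j) ≡⟨ ∑-const (removeColour a Q) (otherColour t j) ⟩
          length (removeColour a Q) * otherColour t j ≡⟨ cong (_* otherColour t j) (length-removeColour u ain l) ⟩
          (1 + t) * otherColour t j ∎
        where open ≡-Reasoning
      ... | no ne = begin
          ∑ (removeColour a Q) (pathValue t j c0) ≡⟨ PC.∑-remove (removeColour a Q) (pathValue t j c0) uQ'
              (∈-removeColour c0in (λ e → ne (sym e))) ⟩
          pathValue t j c0 c0 + ∑ (removeColour c0 (removeColour a Q)) (pathValue t j c0) ≡⟨ cong₂ _+_
              (pathValue-≡ {t} {j} {c0})
               (∑-cong (removeColour c0 (removeColour a Q))
                   (λ bin → pathValue-≢ {t} {j} {c0} (proj₂ (∈-filter⁻ (PC.≢? c0) {xs = removeColour a Q} bin)))) ⟩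
          sameColour t j + ∑ (removeColour c0 (removeColour a Q)) (λ _ → otherColour t j) ≡⟨ cong (sameColour t j +_)
              (∑-const (removeColour c0 (removeColour a Q)) (otherColour t j)) ⟩
          sameColour t j + length (removeColour c0 (removeColour a Q)) * otherColour t j ≡⟨ cong
              (λ z → sameColour t j + z * otherColour t j)
               (length-removeColour uQ' (∈-removeColour c0in (λ e → ne (sym e))) (length-removeColour u ain l)) ⟩
          sameColour t j + t * otherColour t j ∎
        where
        open ≡-Reasoning
        uQ' = UP.filter⁺ (PC.≢? a) u

      not-adjacent : ∀ {i l} → i < n → l < n → ¬ CycleAdjacent n i l → A (cv i) (cv l) ≡ false
      not-adjacent {i} {l} i<n l<n ¬c with A (cv i) (cv l) in eq
      ... | false = refl
      ... | true = ⊥-elim (¬c (A⇒adjacent i<n l<n eq))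

      no-conflicts-cycleFibres : ∀ {u} a (Q : List Col) l k → (∀ {p} → l ≤ p → p < l + k → A u (cv p) ≡ false × ¬ u ≡ cv p) →
                   NoConflicts* (mk u a) (cycleFibres Q l k)
      no-conflicts-cycleFibres a Q l zero h = tt
      no-conflicts-cycleFibres a Q l (suc k) h =
        no-conflicts-nonadjacent a Q (proj₁ (h ≤-refl (m<m+n l (s≤s z≤n)))) (proj₂ (h ≤-refl (m<m+n l (s≤s z≤n)))) ,
        no-conflicts-cycleFibres a Q (suc l) k
            (λ le lt → h (≤-trans (n≤1+n l) le) (≤-trans lt (≤-reflexive (sym (+-suc l k)))))

      compatibleCount-pathValue : ∀ {t c0 b} {w : Vt} → A (cv 0) w ≡ true → compatibleCount (mk (cv 0) c0)
          (mk w b) ≡ pathValue t 0 c0 b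
      compatibleCount-pathValue {t} {c0} {b} {w} e rewrite R-mk (cv 0) w c0 b (A-ne e) | e with b ≟c c0 | c0 ≟c b
      ... | yes _ | yes _ = refl
      ... | yes e' | no ne = ⊥-elim (ne (sym e'))
      ... | no ne | yes e' = ⊥-elim (ne (sym e'))
      ... | no _ | no _ = refl

      chainCount-pathValue : ∀ t j i {Q : List Col} {c0} → Unique Q → length Q ≡ 2 + t → c0 ∈ Q →
          1 ≤ i → i + suc (suc j) ≡ n →
              ∀ {a} → a ∈ Q → chainCount (mk (cv 0) c0) (cycleFibres Q (suc i) (suc j))
                  (mk (cv i) a) ≡ pathValue t (suc j) c0 a
      chainCount-pathValue t zero i {Q} {c0} u l c0in i≥1 eqn {a} ain = begin
          #transversals (filter (compatible? z) (filter (compatible? x) B) ∷ [])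
            ≡⟨ #transversals-single (filter (compatible? z) (filter (compatible? x) B)) ⟩
          length (filter (compatible? z) (filter (compatible? x) B))
            ≡⟨ cong length (filter-comm (compatible? z) (compatible? x) B) ⟩
          length (filter (compatible? x) (filter (compatible? z) B))
            ≡⟨ length-compatible x (filter (compatible? z) B) ⟩
          ∑ (filter (compatible? z) B) (compatibleCount x)
            ≡⟨ cong (λ M → ∑ M (compatibleCount x)) (prune-fibre-adjacent a Q (adjacent⇒A i<n' si<n' (inj₁ refl))) ⟩
          ∑ (fibre (removeColour a Q) w) (compatibleCount x)
            ≡⟨ ∑-map (removeColour a Q) (mk w) (compatibleCount x) ⟩
          ∑ (removeColour a Q) (compatibleCount x ∘ mk w)
            ≡⟨ ∑-cong (removeColour a Q) (λ _ → compatibleCount-pathValue {t}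
                (adjacent⇒A 0<n' si<n' (inj₂ (inj₂ (inj₁ (refl , en)))))) ⟩
          ∑ (removeColour a Q) (pathValue t 0 c0)
            ≡⟨ ∑-pathValue {t} {0} u l c0in ain ⟩
          pathValue t 1 c0 a ∎
        where
        open ≡-Reasoning
        x = mk (cv 0) c0
        z = mk (cv i) a
        w = cv (suc i)
        B = fibre Q w
        en : suc (suc i) ≡ n
        en = trans (+-comm 2 i) eqn
        si<n' : suc i < n
        si<n' = ≤-reflexive en
        i<n' : i < n
        i<n' = ≤-trans (n≤1+n _) si<n'
        0<n' : 0 < n
        0<n' = ≤-trans (s≤s z≤n) si<n'
      chainCount-pathValue t (suc j) i {Q} {c0} u l c0in i≥1 eqn {a} ain = begin
          #transversals (filter (compatible? z) (filter (compatible? x) B) ∷ prune z (prune x Ps))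
            ≡⟨ cong₂ (λ C Cs → #transversals (filter (compatible? z) C ∷ Cs))
                     (prune-no-conflicts x B (no-conflicts-nonadjacent c0 Q
                         (not-adjacent 0<n sin<n (non-adjacent-from-0 (s≤s i≥1) ssi≤n))
                                           (λ e → 0≢1+n (cvinj 0<n sin<n e))))
                     (prune*-no-conflicts z (prune x Ps) (no-conflicts-prune z x Ps
                        (no-conflicts-cycleFibres a Q (suc (suc i)) (suc j)
                            (λ le lt → not-adjacent i<n (≤-trans lt (≤-reflexive lend)) (non-adjacent-apart i≥1 le) ,
                                                                         (λ e → 1+n≰n (≤-trans (≤-trans (n≤1+n _) le)
                                                                             (≤-reflexive (sym (cvinj i<n (≤-trans lt
                                                                                 (≤-reflexive lend)) e))))))))) ⟩
          #transversals (filter (compatible? z) B ∷ prune x Ps)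
            ≡⟨ #transversals-∷ (filter (compatible? z) B) (prune x Ps) ⟩
          ∑ (filter (compatible? z) B) (chainCount x Ps)
            ≡⟨ cong (λ M → ∑ M (chainCount x Ps)) (prune-fibre-adjacent a Q (adjacent⇒A i<n sin<n (inj₁ refl))) ⟩
          ∑ (fibre (removeColour a Q) w) (chainCount x Ps)
            ≡⟨ ∑-map (removeColour a Q) (mk w) (chainCount x Ps) ⟩
          ∑ (removeColour a Q) (chainCount x Ps ∘ mk w)
            ≡⟨ ∑-cong (removeColour a Q) (λ bin → chainCount-pathValue t j (suc i) u l c0in (≤-trans i≥1 (n≤1+n i))
                                            (trans (sym (+-suc i (suc (suc j)))) eqn)
                                            (proj₁ (∈-filter⁻ (PC.≢? a) {xs = Q} bin))) ⟩
          ∑ (removeColour a Q) (pathValue t (suc j) c0)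
            ≡⟨ ∑-pathValue {t} {suc j} u l c0in ain ⟩
          pathValue t (suc (suc j)) c0 a ∎
        where
        open ≡-Reasoning
        x = mk (cv 0) c0
        z = mk (cv i) a
        w = cv (suc i)
        B = fibre Q w
        Ps = cycleFibres Q (suc (suc i)) (suc j)
        lend : suc (suc i) + suc j ≡ n
        lend = trans (cong suc (sym (+-suc i (suc j)))) (trans (sym (+-suc i (suc (suc j)))) eqn)
        ssi≤n : suc (suc (suc i)) ≤ n
        ssi≤n = ≤-trans (≤-reflexive (+-comm 3 i)) (≤-trans (+-monoʳ-≤ i (m≤m+n 3 j)) (≤-reflexive eqn))
        sin<n : suc i < n
        sin<n = ≤-trans (n≤1+n _) ssi≤n
        i<n : i < n
        i<n = ≤-trans (n≤1+n _) sin<n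
        0<n : 0 < n
        0<n = ≤-trans (s≤s z≤n) (<⇒≤ sin<n)

      #transversals-cycleFibres : ∀ j (Q : List Col) → 3 + j ≡ n → #transversals (cycleFibres Q 0 (3 + j)) ≡
             ∑ Q (λ c0 → ∑ (removeColour c0 Q) (λ a → chainCount (mk (cv 0) c0) (cycleFibres Q 2 (suc j)) (mk (cv 1) a)))
      #transversals-cycleFibres j Q eqn = begin
          #transversals (fibre Q (cv 0) ∷ fibre Q (cv 1) ∷ Ps) ≡⟨ #transversals-∷ (fibre Q (cv 0)) (fibre Q (cv 1) ∷ Ps) ⟩
          ∑ (map (mk (cv 0)) Q) (λ x → #transversals (prune x (fibre Q (cv 1) ∷ Ps))) ≡⟨ ∑-map Q (mk (cv 0))
              (λ x → #transversals (prune x (fibre Q (cv 1) ∷ Ps))) ⟩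
          ∑ Q (λ c0 → #transversals (filter (compatible? (mk (cv 0) c0)) (fibre Q (cv 1)) ∷ prune (mk (cv 0) c0) Ps))
            ≡⟨ ∑-cong Q (λ {c0} _ → trans (#transversals-∷ (filter (compatible? (mk (cv 0) c0)) (fibre Q (cv 1)))
                (prune (mk (cv 0) c0) Ps))
                   (trans (cong (λ M → ∑ M (chainCount (mk (cv 0) c0) Ps))
                       (prune-fibre-adjacent c0 Q (adjacent⇒A 0<n 1<n (inj₁ refl))))
                          (∑-map (removeColour c0 Q) (mk (cv 1)) (chainCount (mk (cv 0) c0) Ps)))) ⟩
          ∑ Q (λ c0 → ∑ (removeColour c0 Q) (λ a → chainCount (mk (cv 0) c0) Ps (mk (cv 1) a))) ∎
        where
        open ≡-Reasoning
        Ps = cycleFibres Q 2 (suc j)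
        1<n : 1 < n
        1<n = ≤-trans (s≤s (s≤s z≤n)) (≤-reflexive eqn)
        0<n : 0 < n
        0<n = ≤-trans (s≤s z≤n) (≤-reflexive eqn)

      canonical-cycle-≤ : ∀ j (Q : List Col) → Unique Q → 3 + j ≡ n → even j ≡ true →
                          #transversals (cycleFibres Q 0 (3 + j)) ≤ cycleCount (length Q) j
      canonical-cycle-≤ j Q u eqn j-even = subst (_≤ cycleCount (length Q) j)
          (sym (#transversals-cycleFibres j Q eqn)) (go Q refl)
        where
        TOP = ∑ Q (λ c0 → ∑ (removeColour c0 Q) (λ a → chainCount (mk (cv 0) c0) (cycleFibres Q 2 (suc j)) (mk (cv 1) a)))
        len0 : (M : List Col) → length M ≡ 0 → M ≡ []
        len0 [] _ = refl
        go : ∀ Q' → Q' ≡ Q → TOP ≤ cycleCount (length Q') j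
        go Q' eq with length Q in lq
        ... | zero = subst (_≤ cycleCount (length Q') j)
            (sym (cong (λ M → ∑ M (λ c0 → ∑ (removeColour c0 Q)
                (λ a → chainCount (mk (cv 0) c0) (cycleFibres Q 2 (suc j)) (mk (cv 1) a)))) (len0 Q lq))) z≤n
        ... | suc zero = subst (_≤ cycleCount (length Q') j)
                           (sym (trans (∑-cong Q (λ {c0} c0in → cong
                               (λ M → ∑ M (λ a → chainCount (mk (cv 0) c0) (cycleFibres Q 2 (suc j)) (mk (cv 1) a)))
                                                            (len0 (removeColour c0 Q) (length-removeColour u c0in lq))))
                                       (trans (∑-const Q 0) (*-zeroʳ (length Q))))) z≤n
        ... | suc (suc t) = ≤-reflexive (begin
            ∑ Q (λ c0 → ∑ (removeColour c0 Q) (λ a → chainCount (mk (cv 0) c0) (cycleFibres Q 2 (suc j)) (mk (cv 1) a)))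
              ≡⟨ ∑-cong Q (λ {c0} c0in → trans
                  (∑-cong (removeColour c0 Q) (λ ain → chainCount-pathValue t j 1 u lq c0in ≤-refl eqn
                      (proj₁ (∈-filter⁻ (PC.≢? c0) {xs = Q} ain))))
                                            (trans (∑-pathValue {t} {suc j} u lq c0in c0in)
                                                (pathValue-≡ {t} {suc (suc j)} {c0}))) ⟩
            ∑ Q (λ _ → (1 + t) * otherColour t (suc j)) ≡⟨ ∑-const Q ((1 + t) * otherColour t (suc j)) ⟩
            length Q * ((1 + t) * otherColour t (suc j)) ≡⟨ cong (_* ((1 + t) * otherColour t (suc j))) lq ⟩
            (2 + t) * ((1 + t) * otherColour t (suc j)) ≡⟨ cong ((2 + t) *_) (sym eE) ⟩
            (2 + t) * chainRest (2 + t) (suc j) ≡⟨ cong (λ z → cycleCount z j) (sym lq') ⟩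
            cycleCount (length Q') j ∎)
          where
          open ≡-Reasoning
          lq' : length Q' ≡ 2 + t
          lq' = trans (cong length eq) lq
          caseF : ClosedFormCase (even (suc j)) t (suc j)
          caseF = proj₂ (chainBounds-closedForm t (suc j))
          eE : chainRest (2 + t) (suc j) ≡ (1 + t) * otherColour t (suc j)
          eE with even j | caseF
          ... | true | (_ , _ , e) = e
          ... | false | _ = ⊥-elim (BoolP.not-¬ j-even refl)

module Colorings where

  open Lists
  open Transversals

  ∣tabulate∘∣ : ∀ {N K} (e : Fin N → Fin K) (g : Fin K → Bool) →
          ∣ V.tabulate (g ∘ e) ∣ ≡ length (filter (λ x → g x BoolP.≟ true) (L.tabulate e))
  ∣tabulate∘∣ {zero} e g = refl
  ∣tabulate∘∣ {suc N} e g with g (e zero) in eq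
  ... | true = cong suc (∣tabulate∘∣ (e ∘ suc) g)
  ... | false = ∣tabulate∘∣ (e ∘ suc) g

  ∣tabulate∣ : ∀ {N} (g : Fin N → Bool) → ∣ V.tabulate g ∣ ≡ length (filter (λ x → g x BoolP.≟ true) (allFin N))
  ∣tabulate∣ g = ∣tabulate∘∣ (λ x → x) g

  ∣∣≡length-members : ∀ {N} (S : Subset N) → ∣ S ∣ ≡ length (filter (λ x → lookup S x BoolP.≟ true) (allFin N))
  ∣∣≡length-members S = trans (cong ∣_∣ (sym (VP.tabulate∘lookup S))) (∣tabulate∣ (lookup S))

  allSubsets-complete : ∀ N (S : Subset N) → S ∈ allSubsets N
  allSubsets-complete zero [] = here refl
  allSubsets-complete (suc N) (true ∷ S) = ∈-++⁺ˡ (∈-map⁺ (true ∷_) (allSubsets-complete N S))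
  allSubsets-complete (suc N) (false ∷ S) = ∈-++⁺ʳ (map (true ∷_) (allSubsets N))
      (∈-map⁺ (false ∷_) (allSubsets-complete N S))

  allSubsets-unique : ∀ N → Unique (allSubsets N)
  allSubsets-unique zero = [] ∷ []
  allSubsets-unique (suc N) = UP.++⁺ (UP.map⁺ VP.∷-injectiveʳ (allSubsets-unique N))
      (UP.map⁺ VP.∷-injectiveʳ (allSubsets-unique N)) disj
    where
    disj : ∀ {v} → ¬ (v ∈ map (true ∷_) (allSubsets N) × v ∈ map (false ∷_) (allSubsets N))
    disj (p , q) with ∈-map⁻ (true ∷_) p | ∈-map⁻ (false ∷_) q
    ... | _ , _ , refl | _ , _ , ()

  _∈?_ : ∀ {N} (x : Fin N) (t : List (Fin N)) → Dec (x ∈ t)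
  x ∈? t = any? (x FinP.≟_) t

  fromList : ∀ {N} → List (Fin N) → Subset N
  fromList t = V.tabulate (λ x → does (x ∈? t))

  ∈-fromList⁺ : ∀ {N} {t : List (Fin N)} {x} → x ∈ t → x ∈ₛ fromList t
  ∈-fromList⁺ {t = t} {x} x∈t = VP.lookup⇒[]= _ _
      (trans (VP.lookup∘tabulate (λ x → does (x ∈? t)) x) (dec-true (x ∈? t) x∈t))

  ∈-fromList⁻ : ∀ {N} {t : List (Fin N)} {x} → x ∈ₛ fromList t → x ∈ t
  ∈-fromList⁻ {t = t} {x} m = go (x ∈? t) (trans (sym (VP.lookup∘tabulate (λ x → does (x ∈? t)) x)) (VP.[]=⇒lookup m))
    where
    go : (d : Dec (x ∈ t)) → does d ≡ true → x ∈ t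
    go (yes p) _ = p
    go (no _) ()

  ∣fromList∣ : ∀ {N} (t : List (Fin N)) → Unique t → ∣ fromList t ∣ ≡ length t
  ∣fromList∣ {N} t u = trans (∣tabulate∣ (λ x → does (x ∈? t))) (≤-antisym le1 le2)
    where
    open Injections (FinP._≟_ {N})
    P? : (x : Fin N) → Dec (does (x ∈? t) ≡ true)
    P? x = does (x ∈? t) BoolP.≟ true
    le1 : length (filter P? (allFin N)) ≤ length t
    le1 = unique-length-≤ (UP.filter⁺ P? (UP.allFin⁺ N))
        (λ xin → ∈-fromList⁻ {t = t} (VP.lookup⇒[]= _ _
            (trans (VP.lookup∘tabulate (λ x → does (x ∈? t)) _) (proj₂ (∈-filter⁻ P? {xs = allFin N} xin)))))
    le2 : length t ≤ length (filter P? (allFin N))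
    le2 = unique-length-≤ u (λ {x} xin → ∈-filter⁺ P? (∈-allFin x)
        (trans (sym (VP.lookup∘tabulate (λ x → does (x ∈? t)) x)) (VP.[]=⇒lookup (∈-fromList⁺ xin))))

  module CoverLists {n m : ℕ} {G : Graph n} (ℋ : Cover G m) where
    NN = N ℋ
    open Conflicts (Hadj ℋ)

    part : Fin n → List (Fin NN)
    part v = filter (λ x → lab ℋ x FinP.≟ v) (allFin NN)

    part-lab : ∀ {v x} → x ∈ part v → lab ℋ x ≡ v
    part-lab {v} xin = proj₂ (∈-filter⁻ (λ x → lab ℋ x FinP.≟ v) {xs = allFin NN} xin)

    parts : ∀ {k} → Vec (Fin n) k → Vec (List (Fin NN)) k
    parts vs = V.map part vs

    map-lab-choice : ∀ {k} (vs : Vec (Fin n) k) t → IsChoice (parts vs) t → map (lab ℋ) t ≡ V.toList vs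
    map-lab-choice [] [] tt = refl
    map-lab-choice (v ∷ vs) (x ∷ t) (xin , _ , p) = cong₂ _∷_ (part-lab xin) (map-lab-choice vs t p)

    choice-injective : ∀ {k} (vs : Vec (Fin n) k) → Unique (V.toList vs) → ∀ t t' → IsChoice
        (parts vs) t → IsChoice (parts vs) t' →
            (∀ {x} → x ∈ t → x ∈ t') → t ≡ t'
    choice-injective [] _ [] [] _ _ _ = refl
    choice-injective (v ∷ vs) (v∉ ∷ u) (x ∷ r) (x' ∷ r') p@(xin , _ , pr) p'@(x'in , _ , pr') sub = cong₂ _∷_ xx
        (choice-injective vs u r r' pr pr' sub')
      where
      notrest : ∀ {y} → y ∈ r' → lab ℋ y ≡ v → ⊥
      notrest yin e = All.lookup v∉ (subst (λ M → lab ℋ _ ∈ M) (map-lab-choice vs r' pr') (∈-map⁺ (lab ℋ) yin)) (sym e)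
      notrest0 : ∀ {y} → y ∈ r → lab ℋ y ≡ v → ⊥
      notrest0 yin e = All.lookup v∉ (subst (λ M → lab ℋ _ ∈ M) (map-lab-choice vs r pr) (∈-map⁺ (lab ℋ) yin)) (sym e)
      xx : x ≡ x'
      xx with sub (here refl)
      ... | here e = e
      ... | there xin' = ⊥-elim (notrest xin' (part-lab xin))
      sub' : ∀ {y} → y ∈ r → y ∈ r'
      sub' {y} yin with sub (there yin)
      ... | here refl = ⊥-elim (notrest0 yin (part-lab x'in))
      ... | there y' = y'

    choice-unique : ∀ {k} (vs : Vec (Fin n) k) → Unique (V.toList vs) → ∀ t → IsChoice (parts vs) t → Unique t
    choice-unique vs u t p = UP.map⁻ (subst Unique (sym (map-lab-choice vs t p)) u)

    #transversals-≤-numHColorings : (vs : Vec (Fin n) n) → Unique (V.toList vs) → #transversals (parts vs) ≤ numHColorings ℋ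
    #transversals-≤-numHColorings vs u = subst (_≤ numHColorings ℋ)
        (cong length (filter-all P? {xs = transversals (parts vs)} (All.tabulate (λ _ → tt))))
                     (count-≤-injection P? (isHColoring? ℋ) (transversals (parts vs)) (allSubsets NN) fromList
                        (transversals-unique (parts vs) (allU vs)) hq (λ _ _ → allSubsets-complete NN _) inj)
      where
      open Injections (VP.≡-dec {n = NN} BoolP._≟_)
      P? : (t : List (Fin NN)) → Dec ⊤
      P? _ = yes tt
      allU : ∀ {k} (ws : Vec (Fin n) k) → AllUnique (parts ws)
      allU [] = tt
      allU (w ∷ ws) = UP.filter⁺ _ (UP.allFin⁺ NN) , allU ws
      choice : ∀ {t} → t ∈ transversals (parts vs) → IsChoice (parts vs) t
      choice tin = transversal⇒choice (parts vs) _ (transversals-sound (parts vs) tin)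
      hq : ∀ {t} → t ∈ transversals (parts vs) → ⊤ → IsHColoring ℋ (fromList t)
      hq {t} tin _ = trans (∣fromList∣ t (choice-unique vs u t (choice tin)))
          (choice-length (parts vs) t (choice tin)) , indep
        where
        indep : Independent (Hadj ℋ) (fromList t)
        indep x y xS yS with choice-compatible (parts vs) t (choice tin) (∈-fromList⁻ {t = t} xS) (∈-fromList⁻ {t = t} yS)
        ... | inj₁ refl = Hirr ℋ x
        ... | inj₂ (inj₁ nc) = nc
        ... | inj₂ (inj₂ nc) = trans (Hsym ℋ x y) nc
      inj : ∀ {t t'} → t ∈ transversals (parts vs) → t' ∈ transversals (parts vs) → ⊤ → ⊤ → fromList t ≡ fromList t' → t ≡ t'
      inj {t} {t'} tin t'in _ _ eq = choice-injective vs u t t' (choice tin) (choice t'in)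
                                       (λ xin → ∈-fromList⁻ {t = t'} (subst (_ ∈ₛ_) eq (∈-fromList⁺ xin)))

module CanonicalCover where

  open Lists
  open Transversals
  open Colorings

  _==_ : ∀ {k} → Fin k → Fin k → Bool
  _==_ a b = ⌊ a FinP.≟ b ⌋

  ==-sym : ∀ {k} (a b : Fin k) → _==_ a b ≡ _==_ b a
  ==-sym a b with a FinP.≟ b | b FinP.≟ a
  ... | yes _ | yes _ = refl
  ... | yes e | no ne = ⊥-elim (ne (sym e))
  ... | no ne | yes e = ⊥-elim (ne (sym e))
  ... | no _ | no _ = refl

  ==-refl : ∀ {k} (a : Fin k) → _==_ a a ≡ true
  ==-refl a with a FinP.≟ a
  ... | yes _ = refl
  ... | no ne = ⊥-elim (ne refl)

  ≢⇒==-false : ∀ {k} {a b : Fin k} → ¬ a ≡ b → _==_ a b ≡ false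
  ≢⇒==-false {a = a} {b} ne with a FinP.≟ b
  ... | yes e = ⊥-elim (ne e)
  ... | no _ = refl

  ==-true⇒≡ : ∀ {k} {a b : Fin k} → _==_ a b ≡ true → a ≡ b
  ==-true⇒≡ {a = a} {b} e with a FinP.≟ b
  ... | yes e' = e'
  ... | no _ with () ← e

  allColorings-complete : ∀ n m (c : Vec (Fin m) n) → c ∈ allColorings n m
  allColorings-complete zero m [] = here refl
  allColorings-complete (suc n) m (a ∷ c) = go (allFin m) (∈-allFin a)
    where
    go : ∀ A → a ∈ A → (a ∷ c) ∈ concatMap (λ c' → map (c' ∷_) (allColorings n m)) A
    go (b ∷ A) (here refl) = ∈-++⁺ˡ (∈-map⁺ (a ∷_) (allColorings-complete n m c))
    go (b ∷ A) (there ain) = ∈-++⁺ʳ (map (b ∷_) (allColorings n m)) (go A ain)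

  allColorings-unique : ∀ n m → Unique (allColorings n m)
  allColorings-unique zero m = [] ∷ []
  allColorings-unique (suc n) m = go (allFin m) (UP.allFin⁺ m)
    where
    go : ∀ A → Unique A → Unique (concatMap (λ c' → map (c' ∷_) (allColorings n m)) A)
    go [] _ = []
    go (b ∷ A) (b∉ ∷ u) = UP.++⁺ (UP.map⁺ VP.∷-injectiveʳ (allColorings-unique n m)) (go A u) disj
      where
      hd : ∀ {A'} {v : Vec (Fin m) (suc n)} → v ∈ concatMap (λ c' → map (c' ∷_) (allColorings n m)) A' → V.head v ∈ A'
      hd {b' ∷ A'} vin with ∈-++⁻ (map (b' ∷_) (allColorings n m)) vin
      ... | inj₁ p with ∈-map⁻ (b' ∷_) p
      ...   | _ , _ , refl = here refl
      hd {b' ∷ A'} vin | inj₂ p = there (hd {A'} p)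
      disj : ∀ {v} → ¬ (v ∈ map (b ∷_) (allColorings n m) × v ∈ concatMap (λ c' → map (c' ∷_) (allColorings n m)) A)
      disj (p , q) with ∈-map⁻ (b ∷_) p
      ... | _ , _ , refl = All.lookup b∉ (hd {A} q) refl

  toList-tabulate : ∀ {A : Set} {n} (f : Fin n → A) → V.toList (V.tabulate f) ≡ L.tabulate f
  toList-tabulate {n = zero} f = refl
  toList-tabulate {n = suc n} f = cong (f zero ∷_) (toList-tabulate (f ∘ suc))

  allFin-unique : ∀ n → Unique (V.toList (V.allFin n))
  allFin-unique n = subst Unique (sym (toList-tabulate (λ x → x))) (UP.allFin⁺ n)

  toList-injective : ∀ {A : Set} {k} (xs ys : Vec A k) → V.toList xs ≡ V.toList ys → xs ≡ ys
  toList-injective [] [] _ = refl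
  toList-injective (x ∷ xs) (y ∷ ys) eq = cong₂ _∷_ (LP.∷-injectiveˡ eq) (toList-injective xs ys (LP.∷-injectiveʳ eq))

  module Canonical {n : ℕ} (G : Graph n) (m : ℕ) where
    NN = n * m
    vertexOf : Fin NN → Fin n
    vertexOf x = proj₁ (remQuot {n} m x)
    colourOf : Fin NN → Fin m
    colourOf x = proj₂ (remQuot {n} m x)

    -- L(u) = {u} × Fin m, and (u , a) is adjacent to (v , b) in another fibre iff uv ∈ E(G) and a = b,
    -- so the H-colorings are exactly the proper m-colorings of G.
    canonicalAdj : Fin NN → Fin NN → Bool
    canonicalAdj x y = (_==_ (vertexOf x) (vertexOf y) ∧ not (_==_ x y)) ∨
        (adj G (vertexOf x) (vertexOf y) ∧ _==_ (colourOf x) (colourOf y))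

    vertexOf-combine : ∀ u a → vertexOf (combine u a) ≡ u
    vertexOf-combine u a = cong proj₁ (FinP.remQuot-combine {n} {m} u a)
    colourOf-combine : ∀ u a → colourOf (combine u a) ≡ a
    colourOf-combine u a = cong proj₂ (FinP.remQuot-combine {n} {m} u a)
    combine-vertexOf-colourOf : ∀ x → combine (vertexOf x) (colourOf x) ≡ x
    combine-vertexOf-colourOf x = FinP.combine-remQuot {n} m x

    combine-injective : ∀ {x y} → vertexOf x ≡ vertexOf y → colourOf x ≡ colourOf y → x ≡ y
    combine-injective {x} {y} e1 e2 = trans (sym (combine-vertexOf-colourOf x))
        (trans (cong₂ combine e1 e2) (combine-vertexOf-colourOf y))

    canonicalAdj-sym : ∀ x y → canonicalAdj x y ≡ canonicalAdj y x
    canonicalAdj-sym x y rewrite ==-sym (vertexOf x) (vertexOf y) | ==-sym x y | Graph.sym G (vertexOf x) (vertexOf y) | ==-sym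
        (colourOf x) (colourOf y) = refl

    canonicalAdj-irrefl : ∀ x → canonicalAdj x x ≡ false
    canonicalAdj-irrefl x rewrite ==-refl x | Graph.irrefl G (vertexOf x) | ==-refl (vertexOf x) = refl

    canonicalAdj-fibre : ∀ x y → vertexOf x ≡ vertexOf y → ¬ x ≡ y → canonicalAdj x y ≡ true
    canonicalAdj-fibre x y e ne rewrite e | ==-refl (vertexOf y) | ≢⇒==-false ne = refl

    canonicalAdj-over : ∀ x y → ¬ vertexOf x ≡ vertexOf y → canonicalAdj x y ≡ true → adj G (vertexOf x) (vertexOf y) ≡ true
    canonicalAdj-over x y ne h rewrite ≢⇒==-false ne with adj G (vertexOf x) (vertexOf y)
    ... | true = refl
    ... | false = h

    canonicalAdj-sameColour : ∀ x y → ¬ vertexOf x ≡ vertexOf y → canonicalAdj x y ≡ true → colourOf x ≡ colourOf y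
    canonicalAdj-sameColour x y ne h rewrite ≢⇒==-false ne with adj G (vertexOf x) (vertexOf y)
    ... | true = ==-true⇒≡ h
    ... | false with () ← h

    canonicalAdj-matching : ∀ x y z → vertexOf x ≢ vertexOf y → adj G (vertexOf x) (vertexOf y) ≡ true →
             vertexOf y ≡ vertexOf z → canonicalAdj x y ≡ true → canonicalAdj x z ≡ true → y ≡ z
    canonicalAdj-matching x y z ne _ e hy hz = combine-injective e
        (trans (sym (canonicalAdj-sameColour x y ne hy)) (canonicalAdj-sameColour x z (λ e' → ne (trans e' (sym e))) hz))

    fibre-size : ∀ u → count (λ x → vertexOf x FinP.≟ u) (allFin NN) ≡ m
    fibre-size u = ≤-antisym le1 le2
      where
      open Injections (FinP._≟_ {NN})
      P? = λ x → vertexOf x FinP.≟ u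
      Mu = map (combine u) (allFin m)
      lenMu : length Mu ≡ m
      lenMu = trans (length-map (combine u) (allFin m)) (LP.length-tabulate (λ x → x))
      uMu : Unique Mu
      uMu = UP.map⁺ (λ {a} {b} e → FinP.combine-injectiveʳ u a u b e) (UP.allFin⁺ m)
      le1 : length (filter P? (allFin NN)) ≤ m
      le1 = subst (length (filter P? (allFin NN)) ≤_) lenMu (unique-length-≤ (UP.filter⁺ P? (UP.allFin⁺ NN))
              (λ {x} xin → subst (_∈ Mu) (trans
                  (sym (cong (λ w → combine w (colourOf x)) (proj₂ (∈-filter⁻ P? {xs = allFin NN} xin))))
                      (combine-vertexOf-colourOf x))
                             (∈-map⁺ (combine u) (∈-allFin (colourOf x)))))
      le2 : m ≤ length (filter P? (allFin NN))
      le2 = subst (_≤ length (filter P? (allFin NN))) lenMu (unique-length-≤ uMu (λ {x} xin → helper xin))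
        where
        helper : ∀ {x} → x ∈ Mu → x ∈ filter P? (allFin NN)
        helper xin with ∈-map⁻ (combine u) xin
        ... | a , _ , refl = ∈-filter⁺ P? (∈-allFin _) (vertexOf-combine u a)

    canonicalCover : Cover G m
    canonicalCover = record
      { N = NN ; Hadj = canonicalAdj ; Hsym = canonicalAdj-sym ; Hirr = canonicalAdj-irrefl ; lab = vertexOf
      ; fold = fibre-size ; clique = canonicalAdj-fibre ; over = canonicalAdj-over ; match = canonicalAdj-matching }

    open Conflicts canonicalAdj

    colourFibre : List (Fin m) → Fin n → List (Fin NN)
    colourFibre Q v = map (combine v) Q

    colouredVertex : Vec (Fin m) n → Fin n → Fin NN
    colouredVertex c v = combine v (lookup c v)

    colouredVertices : ∀ {k} → Vec (Fin m) n → Vec (Fin n) k → List (Fin NN)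
    colouredVertices c vs = V.toList (V.map (colouredVertex c) vs)

    proper⇒compatible : ∀ {c : Vec (Fin m) n} {v w} → Proper G c → ¬ v ≡ w → canonicalAdj (colouredVertex c v)
        (colouredVertex c w) ≡ false
    proper⇒compatible {c} {v} {w} pr ne rewrite vertexOf-combine v (lookup c v) | vertexOf-combine w
        (lookup c w) | colourOf-combine v (lookup c v) | colourOf-combine w (lookup c w)
                              | ≢⇒==-false ne with adj G v w in eq
    ... | false = refl
    ... | true = ≢⇒==-false (pr v w eq)

    proper⇒choice : ∀ {k} (c : Vec (Fin m) n) (vs : Vec (Fin n) k) → Proper G c → Unique (V.toList vs) →
            IsChoice (V.map (colourFibre (allFin m)) vs) (colouredVertices c vs)
    proper⇒choice c [] pr u = tt
    proper⇒choice c (v ∷ vs) pr (v∉ ∷ u) = ∈-map⁺ (combine v) (∈-allFin (lookup c v)) , allnc vs v∉ , proper⇒choice c vs pr u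
      where
      allnc : ∀ {k} (ws : Vec (Fin n) k) → All (λ w → ¬ v ≡ w) (V.toList ws) → All
          (Compatible (colouredVertex c v)) (colouredVertices c ws)
      allnc [] [] = []
      allnc (w ∷ ws) (p ∷ ps) = proper⇒compatible {c} pr p ∷ allnc ws ps

    chromPoly-≤-#transversals : chromPoly G m ≤ #transversals (V.map (colourFibre (allFin m)) (V.allFin n))
    chromPoly-≤-#transversals = subst (chromPoly G m ≤_)
        (cong length (filter-all P? {xs = transversals parts} (All.tabulate (λ _ → tt))))
                  (count-≤-injection (proper? G) P? (allColorings n m) (transversals parts)
                      (λ c → colouredVertices c (V.allFin n))
                     (allColorings-unique n m) (λ _ _ → tt)
                     (λ {c} _ pr → transversals-complete parts
                         (choice⇒transversal parts _ (proper⇒choice c (V.allFin n) pr (allFin-unique n))))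
                     inj)
      where
      open Injections (LP.≡-dec (FinP._≟_ {NN}))
      parts = V.map (colourFibre (allFin m)) (V.allFin n)
      P? : (t : List (Fin NN)) → Dec ⊤
      P? _ = yes tt
      inj : ∀ {c c'} → c ∈ allColorings n m → c' ∈ allColorings n m → Proper G c → Proper G c' →
            colouredVertices c (V.allFin n) ≡ colouredVertices c' (V.allFin n) → c ≡ c'
      inj {c} {c'} _ _ _ _ eq = trans (sym (VP.tabulate∘lookup c)) (trans (VP.tabulate-cong pt) (VP.tabulate∘lookup c'))
        where
        eqV : V.tabulate (colouredVertex c) ≡ V.tabulate (colouredVertex c')
        eqV = trans (VP.tabulate-allFin (colouredVertex c))
            (trans (toList-injective _ _ eq) (sym (VP.tabulate-allFin (colouredVertex c'))))
        pt : ∀ v → lookup c v ≡ lookup c' v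
        pt v = FinP.combine-injectiveʳ v (lookup c v) v (lookup c' v)
                 (trans (sym (VP.lookup∘tabulate (colouredVertex c) v))
                     (trans (cong (λ w → lookup w v) eqV) (VP.lookup∘tabulate (colouredVertex c') v)))

  module CanonicalColorings {n : ℕ} (G : Graph n) (m' : ℕ) where
    open Canonical G (suc m')
    module PF = Removal (FinP._≟_ {n})

    anyS : (S : Subset NN) (v : Fin n) → Dec (∃ λ a → combine v a ∈ₛ S)
    anyS S v = FinP.any? (λ a → combine v a SubP.∈? S)

    chosenColour : Subset NN → Fin n → Fin (suc m')
    chosenColour S v with anyS S v
    ... | yes (a , _) = a
    ... | no _ = zero

    indepC : ∀ {S} → IsHColoring canonicalCover S → ∀ {x y} → x ∈ₛ S → y ∈ₛ S → canonicalAdj x y ≡ false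
    indepC h xS yS = proj₂ h _ _ xS yS

    fibre-meets-coloring : ∀ {S} → IsHColoring canonicalCover S → ∀ v → ¬ (∃ λ a → combine v a ∈ₛ S) → ⊥
    fibre-meets-coloring {S} h v ¬ex = 1+n≰n (begin
        suc n ≡⟨ cong suc (sym (trans (sym (∣∣≡length-members S)) (proj₁ h))) ⟩
        suc (length E) ≡⟨ cong suc (sym (length-map vertexOf E)) ⟩
        suc (length (map vertexOf E)) ≤⟨ s≤s
            (unique-length-≤ (unique-map⁺ vertexOf (UP.filter⁺ P? (UP.allFin⁺ NN)) injE) subE) ⟩
        suc (length (PF.remove v (allFin n))) ≤⟨ PF.length-remove-< (∈-allFin v) ⟩
        length (allFin n) ≡⟨ LP.length-tabulate (λ x → x) ⟩
        n ∎)
      where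
      open ≤-Reasoning
      open Injections (FinP._≟_ {n})
      P? = λ (x : Fin NN) → lookup S x BoolP.≟ true
      E = filter P? (allFin NN)
      inS : ∀ {x} → x ∈ E → x ∈ₛ S
      inS xin = VP.lookup⇒[]= _ _ (proj₂ (∈-filter⁻ P? {xs = allFin NN} xin))
      injE : ∀ {x y} → x ∈ E → y ∈ E → vertexOf x ≡ vertexOf y → x ≡ y
      injE {x} {y} xin yin e with x FinP.≟ y
      ... | yes eq = eq
      ... | no ne = ⊥-elim (BoolP.not-¬ (canonicalAdj-fibre x y e ne) (indepC h (inS xin) (inS yin)))
      subE : ∀ {u} → u ∈ map vertexOf E → u ∈ PF.remove v (allFin n)
      subE {u} uin with ∈-map⁻ vertexOf uin
      ... | x , xin , refl = ∈-filter⁺ (PF.≢? v) (∈-allFin _)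
             (λ e → ¬ex (colourOf x , subst (_∈ₛ S)
                 (trans (sym (combine-vertexOf-colourOf x)) (cong (λ w → combine w (colourOf x)) e)) (inS xin)))

    chosenColour-∈ : ∀ {S} → IsHColoring canonicalCover S → ∀ v → combine v (chosenColour S v) ∈ₛ S
    chosenColour-∈ {S} h v with anyS S v
    ... | yes (a , p) = p
    ... | no ¬ex = ⊥-elim (fibre-meets-coloring h v ¬ex)

    coloringOf : Subset NN → Vec (Fin (suc m')) n
    coloringOf S = V.tabulate (chosenColour S)

    ∈-coloring-unique : ∀ {S} → IsHColoring canonicalCover S → ∀ {x} → x ∈ₛ S → x ≡ combine (vertexOf x)
        (chosenColour S (vertexOf x))
    ∈-coloring-unique {S} h {x} xS with x FinP.≟ combine (vertexOf x) (chosenColour S (vertexOf x))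
    ... | yes e = e
    ... | no ne = ⊥-elim (BoolP.not-¬ (canonicalAdj-fibre x _ (sym (vertexOf-combine (vertexOf x) _)) ne)
        (indepC h xS (chosenColour-∈ h (vertexOf x))))

    numHColorings-canonical-≤ : numHColorings canonicalCover ≤ chromPoly G (suc m')
    numHColorings-canonical-≤ = count-≤-injection (isHColoring? canonicalCover) (proper? G) (allSubsets NN)
        (allColorings n (suc m')) coloringOf
             (allSubsets-unique NN) hq (λ {S} _ _ → allColorings-complete n (suc m') (coloringOf S)) inj
      where
      open Injections (VP.≡-dec {n = n} (FinP._≟_ {suc m'}))
      hq : ∀ {S} → S ∈ allSubsets NN → IsHColoring canonicalCover S → Proper G (coloringOf S)
      hq {S} _ h u v a eq = BoolP.not-¬ hadj (indepC h (chosenColour-∈ h u) (chosenColour-∈ h v))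
        where
        pu = chosenColour S u
        pv = chosenColour S v
        e : pu ≡ pv
        e = trans (sym (VP.lookup∘tabulate (chosenColour S) u)) (trans eq (VP.lookup∘tabulate (chosenColour S) v))
        une : ¬ u ≡ v
        une refl = BoolP.not-¬ a (Graph.irrefl G u)
        hadj : canonicalAdj (combine u pu) (combine v pv) ≡ true
        hadj rewrite vertexOf-combine u pu | vertexOf-combine v pv | colourOf-combine u pu | colourOf-combine v pv | ≢⇒==-false une | a | e | ==-refl pv = refl
      inj : ∀ {S S'} → S ∈ allSubsets NN → S' ∈ allSubsets NN → IsHColoring canonicalCover S →
          IsHColoring canonicalCover S' →
            coloringOf S ≡ coloringOf S' → S ≡ S'
      inj {S} {S'} _ _ h h' eq = SubP.⊆-antisym (sub h h' eq) (sub h' h (sym eq))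
        where
        sub : ∀ {T T'} → IsHColoring canonicalCover T → IsHColoring canonicalCover T' →
            coloringOf T ≡ coloringOf T' → ∀ {x} → x ∈ₛ T → x ∈ₛ T'
        sub {T} {T'} hT hT' e {x} xT = subst (_∈ₛ T') (sym (trans (∈-coloring-unique hT xT) (cong (combine (vertexOf x)) pe)))
            (chosenColour-∈ hT' (vertexOf x))
          where
          pe : chosenColour T (vertexOf x) ≡ chosenColour T' (vertexOf x)
          pe = trans (sym (VP.lookup∘tabulate (chosenColour T) (vertexOf x)))
              (trans (cong (λ w → lookup w (vertexOf x)) e) (VP.lookup∘tabulate (chosenColour T') (vertexOf x)))

module Join where

  open Cycles using (CycleAdjacent)
  open CanonicalCount using (upFrom)
  open Lists
  open Transversals
  open CycleBound using (cycleCount)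
  open CliquePeeling using (falling)
  open Colorings
  open CanonicalCover using (allFin-unique)

  suc-mod : ∀ L a → a < suc L → (suc a % suc L ≡ suc a × suc a < suc L) ⊎ (suc a % suc L ≡ 0 × suc a ≡ suc L)
  suc-mod L a a<n with suc a <? suc L
  ... | yes lt = inj₁ (m<n⇒m%n≡m lt , lt)
  ... | no nlt = inj₂ (trans (cong (_% suc L) e) (n%n≡0 (suc L)) , e)
    where
    e : suc a ≡ suc L
    e = ≤-antisym a<n (≮⇒≥ nlt)

  ∨-true : ∀ {a b} → a ∨ b ≡ true → a ≡ true ⊎ b ≡ true
  ∨-true {true} _ = inj₁ refl
  ∨-true {false} e = inj₂ e

  ⌊⌋-true : ∀ {a b : ℕ} → ⌊ a ≟ b ⌋ ≡ true → a ≡ b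
  ⌊⌋-true {a} {b} e with a ≟ b
  ... | yes p = p
  ... | no _ with () ← e

  ⌊⌋-intro : ∀ {a b : ℕ} → a ≡ b → ⌊ a ≟ b ⌋ ≡ true
  ⌊⌋-intro {a} {b} e with a ≟ b
  ... | yes _ = refl
  ... | no ne = ⊥-elim (ne e)

  cycleAdj⇒CycleAdjacent : ∀ L (i l : Fin (suc L)) → cycleAdj (suc L) i l ≡ true → CycleAdjacent (suc L) (toℕ i) (toℕ l)
  cycleAdj⇒CycleAdjacent L i l e with ∨-true {⌊ suc (toℕ i) % suc L ≟ toℕ l ⌋} e
  ... | inj₁ e1 with suc-mod L (toℕ i) (FinP.toℕ<n i)
  ...   | inj₁ (m , _) = inj₁ (trans (sym m) (⌊⌋-true e1))
  ...   | inj₂ (m , q) = inj₂ (inj₂ (inj₂ (trans (sym (⌊⌋-true e1)) m , q)))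
  cycleAdj⇒CycleAdjacent L i l e | inj₂ e2 with suc-mod L (toℕ l) (FinP.toℕ<n l)
  ...   | inj₁ (m , _) = inj₂ (inj₁ (trans (sym m) (⌊⌋-true e2)))
  ...   | inj₂ (m , q) = inj₂ (inj₂ (inj₁ (trans (sym (⌊⌋-true e2)) m , q)))

  CycleAdjacent⇒cycleAdj : ∀ L (i l : Fin (suc L)) → CycleAdjacent (suc L) (toℕ i) (toℕ l) → cycleAdj (suc L) i l ≡ true
  CycleAdjacent⇒cycleAdj L i l (inj₁ e) with suc-mod L (toℕ i) (FinP.toℕ<n i)
  ... | inj₁ (m , _) rewrite ⌊⌋-intro {suc (toℕ i) % suc L} {toℕ l} (trans m e) = refl
  ... | inj₂ (_ , q) = ⊥-elim (<⇒≢ (FinP.toℕ<n l) (trans (sym e) q))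
  CycleAdjacent⇒cycleAdj L i l (inj₂ (inj₁ e)) with suc-mod L (toℕ l) (FinP.toℕ<n l)
  ... | inj₁ (m , _) rewrite ⌊⌋-intro {suc (toℕ l) % suc L} {toℕ i} (trans m e) = BoolP.∨-zeroʳ _
  ... | inj₂ (_ , q) = ⊥-elim (<⇒≢ (FinP.toℕ<n i) (trans (sym e) q))
  CycleAdjacent⇒cycleAdj L i l (inj₂ (inj₂ (inj₁ (e0 , q)))) with suc-mod L (toℕ l) (FinP.toℕ<n l)
  ... | inj₁ (_ , lt) = ⊥-elim (<⇒≢ lt q)
  ... | inj₂ (m , _) rewrite ⌊⌋-intro {suc (toℕ l) % suc L} {toℕ i} (trans m (sym e0)) = BoolP.∨-zeroʳ _
  CycleAdjacent⇒cycleAdj L i l (inj₂ (inj₂ (inj₂ (e0 , q)))) with suc-mod L (toℕ i) (FinP.toℕ<n i)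
  ... | inj₁ (_ , lt) = ⊥-elim (<⇒≢ lt q)
  ... | inj₂ (m , _) rewrite ⌊⌋-intro {suc (toℕ i) % suc L} {toℕ l} (trans m (sym e0)) = refl

  module Layout (p L : ℕ) where
    n' = suc L
    V = p + n'

    joinAdj-cycle : ∀ (i l : Fin n') → joinAdj p n' (p ↑ʳ i) (p ↑ʳ l) ≡ cycleAdj n' i l
    joinAdj-cycle i l rewrite FinP.splitAt-↑ʳ p n' i | FinP.splitAt-↑ʳ p n' l = refl

    joinAdj-clique : ∀ (i : Fin p) (v : Fin V) → ¬ v ≡ i ↑ˡ n' → joinAdj p n' (i ↑ˡ n') v ≡ true
    joinAdj-clique i v ne rewrite FinP.splitAt-↑ˡ p i n' with splitAt p v in eq
    ... | inj₁ j with i FinP.≟ j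
    ...   | yes refl = ⊥-elim (ne (sym (FinP.splitAt⁻¹-↑ˡ eq)))
    ...   | no _ = refl
    joinAdj-clique i v ne | inj₂ j = refl

    cycleIndex : ℕ → Fin n'
    cycleIndex i with i <? n'
    ... | yes lt = fromℕ< lt
    ... | no _ = zero

    toℕ-cycleIndex : ∀ {i} → i < n' → toℕ (cycleIndex i) ≡ i
    toℕ-cycleIndex {i} lt with i <? n'
    ... | yes lt' = FinP.toℕ-fromℕ< lt'
    ... | no nlt = ⊥-elim (nlt lt)

    cycleIndex-toℕ : ∀ (x : Fin n') → cycleIndex (toℕ x) ≡ x
    cycleIndex-toℕ x = FinP.toℕ-injective (toℕ-cycleIndex (FinP.toℕ<n x))

    cycleVertex : ℕ → Fin V
    cycleVertex i = p ↑ʳ cycleIndex i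

    cycleVertex-toℕ : ∀ (x : Fin n') → cycleVertex (toℕ x) ≡ p ↑ʳ x
    cycleVertex-toℕ x = cong (p ↑ʳ_) (cycleIndex-toℕ x)

    cycleVertex-injective : ∀ {i l} → i < n' → l < n' → cycleVertex i ≡ cycleVertex l → i ≡ l
    cycleVertex-injective {i} {l} lt lt' e = trans (sym (toℕ-cycleIndex lt))
        (trans (cong toℕ (FinP.↑ʳ-injective p _ _ e)) (toℕ-cycleIndex lt'))

    cycleVertex-adjacent⁻ : ∀ {i l} → i < n' → l < n' → joinAdj p n' (cycleVertex i)
        (cycleVertex l) ≡ true → CycleAdjacent n' i l
    cycleVertex-adjacent⁻ {i} {l} lt lt' e = subst₂ (CycleAdjacent n') (toℕ-cycleIndex lt) (toℕ-cycleIndex lt')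
        (cycleAdj⇒CycleAdjacent L (cycleIndex i) (cycleIndex l)
            (trans (sym (joinAdj-cycle (cycleIndex i) (cycleIndex l))) e))

    cycleVertex-adjacent⁺ : ∀ {i l} → i < n' → l < n' → CycleAdjacent n' i l → joinAdj p n'
        (cycleVertex i) (cycleVertex l) ≡ true
    cycleVertex-adjacent⁺ {i} {l} lt lt' c = trans (joinAdj-cycle (cycleIndex i) (cycleIndex l))
        (CycleAdjacent⇒cycleAdj L (cycleIndex i) (cycleIndex l)
            (subst₂ (CycleAdjacent n') (sym (toℕ-cycleIndex lt)) (sym (toℕ-cycleIndex lt')) c))

    cliqueVertices : Vec (Fin V) p
    cliqueVertices = V.tabulate (_↑ˡ n')

    cycleVertices : Vec (Fin V) n'
    cycleVertices = V.map cycleVertex (upFrom 0 n')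

    allFin-+ : ∀ q r → V.allFin (q + r) ≡ V.tabulate (_↑ˡ r) V.++ V.tabulate (q ↑ʳ_)
    allFin-+ zero r = refl
    allFin-+ (suc q) r = cong (zero ∷_) (begin
        V.tabulate suc ≡⟨ VP.tabulate-∘ suc (λ x → x) ⟩
        V.map suc (V.allFin (q + r)) ≡⟨ cong (V.map suc) (allFin-+ q r) ⟩
        V.map suc (V.tabulate (_↑ˡ r) V.++ V.tabulate (q ↑ʳ_)) ≡⟨ VP.map-++ suc (V.tabulate (_↑ˡ r)) (V.tabulate (q ↑ʳ_)) ⟩
        V.map suc (V.tabulate (_↑ˡ r)) V.++ V.map suc (V.tabulate (q ↑ʳ_))
          ≡⟨ sym (cong₂ V._++_ (VP.tabulate-∘ suc (_↑ˡ r)) (VP.tabulate-∘ suc (q ↑ʳ_))) ⟩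
        V.tabulate (λ i → suc (i ↑ˡ r)) V.++ V.tabulate (λ i → suc (q ↑ʳ i)) ∎)
      where open ≡-Reasoning

    tabulate-cycleVertex : ∀ k i (f : Fin k → Fin n') → (∀ j → toℕ (f j) ≡ i + toℕ j) → V.tabulate
        (λ j → p ↑ʳ f j) ≡ V.map cycleVertex (upFrom i k)
    tabulate-cycleVertex zero i f h = refl
    tabulate-cycleVertex (suc k) i f h = cong₂ _∷_
        (sym (trans (cong cycleVertex (sym (trans (h zero) (+-identityʳ i)))) (cycleVertex-toℕ (f zero))))
                                     (tabulate-cycleVertex k (suc i) (f ∘ suc) (λ j → trans (h (suc j)) (+-suc i (toℕ j))))

    allFin-join : V.allFin V ≡ cliqueVertices V.++ cycleVertices
    allFin-join = trans (allFin-+ p n') (cong (cliqueVertices V.++_) (tabulate-cycleVertex n' 0 (λ j → j) (λ j → refl)))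

    InClique : ∀ {j} → Vec (Fin V) j → Set
    InClique [] = ⊤
    InClique (a ∷ as) = (∃ λ (i : Fin p) → a ≡ i ↑ˡ n') × InClique as

    InClique-tabulate : ∀ {q} (g : Fin q → Fin p) → InClique (V.tabulate (λ j → g j ↑ˡ n'))
    InClique-tabulate {zero} g = tt
    InClique-tabulate {suc q} g = (g zero , refl) , InClique-tabulate (g ∘ suc)

    vertices-unique : Unique (V.toList (cliqueVertices V.++ cycleVertices))
    vertices-unique = subst (λ w → Unique (V.toList w)) allFin-join (allFin-unique V)

  module LowerBound (p L : ℕ) (G : Graph (p + suc L)) (G≡join : ∀ x y → adj G x y ≡ joinAdj p (suc L) x y)
            (k' : ℕ) (cycle-length : suc L ≡ 3 + k') {m : ℕ} (ℋ : Cover G m) where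
    open Layout p L
    open CoverLists ℋ
    open Conflicts (Hadj ℋ) using (#transversals)
    open CliquePeeling.Peeling (FinP._≟_ {NN}) (Hadj ℋ)
    X = Fin NN

    OnCycle : X → Set
    OnCycle x = ∃ λ (i : Fin n') → lab ℋ x ≡ p ↑ʳ i

    position : X → ℕ
    position x = toℕ (lab ℋ x) ∸ p

    position-↑ʳ : ∀ {x i} → lab ℋ x ≡ p ↑ʳ i → position x ≡ toℕ i
    position-↑ʳ {x} {i} e = trans (cong (λ v → toℕ v ∸ p) e) (trans (cong (_∸ p) (FinP.toℕ-↑ʳ p i)) (m+n∸m≡n p (toℕ i)))

    position-injective : ∀ {x y} → OnCycle x → OnCycle y → position x ≡ position y → lab ℋ x ≡ lab ℋ y
    position-injective {x} {y} (i , ex) (l , ey) e =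
      trans ex (trans (cong (p ↑ʳ_) (FinP.toℕ-injective (trans (sym (position-↑ʳ ex)) (trans e (position-↑ʳ ey))))) (sym ey))

    adjacent-positions : ∀ {z y} → OnCycle z → OnCycle y → Hadj ℋ z y ≡ true → position z ≡ position y ⊎ CycleAdjacent n'
        (position z) (position y)
    adjacent-positions {z} {y} cz@(i , ez) cy@(l , ey) h with lab ℋ z FinP.≟ lab ℋ y
    ... | yes e = inj₁ (cong (λ v → toℕ v ∸ p) e)
    ... | no ne = inj₂ (subst₂ (CycleAdjacent n') (sym (position-↑ʳ ez)) (sym (position-↑ʳ ey))
                     (cycleAdj⇒CycleAdjacent L i l (trans (sym (joinAdj-cycle i l))
                         (trans (sym (G≡join _ _)) (subst₂ (λ a b → adj G a b ≡ true) ez ey (over ℋ z y ne h))))))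

    matching : ∀ {z y y'} → OnCycle z → OnCycle y → OnCycle y' → position y ≡ position y' → ¬ position z ≡ position y →
         Hadj ℋ z y ≡ true → Hadj ℋ z y' ≡ true → y ≡ y'
    matching {z} {y} {y'} cz cy cy' e ne r r' =
      match ℋ z y y' ne' (over ℋ z y ne' r) (position-injective cy cy' e) r r'
      where
      ne' : ¬ lab ℋ z ≡ lab ℋ y
      ne' eq = ne (cong (λ v → toℕ v ∸ p) eq)

    open Cycles.CycleCover (FinP._≟_ {NN}) (Hadj ℋ) (Hsym ℋ) OnCycle position n' adjacent-positions matching using
        (AtPosition; AtPositions; AtPositions-Sublists)
    open CycleBound.CycleCoverBound (FinP._≟_ {NN}) (Hadj ℋ)
        (Hsym ℋ) OnCycle position n' adjacent-positions matching using (cycle-bounded)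

    parts-atPositions : ∀ k i → i + k ≤ n' → AtPositions i (V.map part (V.map cycleVertex (upFrom i k)))
    parts-atPositions zero i _ = tt
    parts-atPositions (suc k) i le = pl , parts-atPositions k (suc i) (≤-trans (≤-reflexive (sym (+-suc i k))) le)
      where
      i<n : i < n'
      i<n = ≤-trans (≤-reflexive (sym (+-identityʳ (suc i))))
          (≤-trans (+-monoʳ-≤ (suc i) z≤n) (≤-trans (≤-reflexive (sym (+-suc i k))) le))
      pl : AtPosition i (part (cycleVertex i))
      pl zin = (cycleIndex i , part-lab zin) , trans (position-↑ʳ (part-lab zin)) (toℕ-cycleIndex i<n)

    cliqueParts = V.map part cliqueVertices
    cycleParts = V.map part cycleVertices

    parts-allFin : parts (V.allFin V) ≡ cliqueParts V.++ cycleParts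
    parts-allFin = trans (cong (V.map part) allFin-join) (VP.map-++ part cliqueVertices cycleVertices)

    CycleBounded-subst : ∀ {n1 n2} (e : n1 ≡ n2) (Ds : Vec (List X) n1) {q b} → CycleBounded q b
        (subst (Vec (List X)) e Ds) → CycleBounded q b Ds
    CycleBounded-subst refl Ds h = h

    AtPositions-subst : ∀ {n1 n2} (e : n1 ≡ n2) (Ds : Vec (List X) n1) {i} → AtPositions i Ds → AtPositions i
        (subst (Vec (List X)) e Ds)
    AtPositions-subst refl Ds h = h

    cycleParts-bounded : ∀ q → CycleBounded q (cycleCount q k') cycleParts
    cycleParts-bounded q = CycleBounded-subst cycle-length cycleParts
        (cycle-bounded (subst (Vec (List X)) cycle-length cycleParts) (sym cycle-length)
            (AtPositions-subst cycle-length cycleParts (parts-atPositions n' 0 ≤-refl)) q)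

    parts-uniqueAtLeast : ∀ {j} (vs : Vec (Fin V) j) → UniqueAtLeast m (V.map part vs)
    parts-uniqueAtLeast [] = tt
    parts-uniqueAtLeast (v ∷ vs) = UP.filter⁺ _ (UP.allFin⁺ NN) , ≤-reflexive (sym (fold ℋ v)) , parts-uniqueAtLeast vs

    parts-matchedInto : ∀ {z} {k} (ws' : Vec (Fin V) k) (i : Fin p) → lab ℋ z ≡ i ↑ˡ n' →
             All (λ w → ¬ i ↑ˡ n' ≡ w) (V.toList ws') → MatchedInto* z (V.map part ws')
    parts-matchedInto [] i e al = tt
    parts-matchedInto {z} (w ∷ ws') i e (ne ∷ al) = h1 , parts-matchedInto ws' i e al
      where
      h1 : Chains.ChainsOver.MatchedInto (FinP._≟_ {NN}) (Hadj ℋ) z (part w)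
      h1 {y} {y'} yin y'in r r' = match ℋ z y y' ne''
          (trans (G≡join _ _) (subst (λ a → joinAdj p n' a (lab ℋ y) ≡ true) (sym e)
                                                 (joinAdj-clique i (lab ℋ y) (λ eq → ne (trans (sym eq) (part-lab yin))))))
                           (trans (part-lab yin) (sym (part-lab y'in))) r r'
        where
        ne'' : ¬ lab ℋ z ≡ lab ℋ y
        ne'' eq = ne (trans (sym e) (trans eq (part-lab yin)))

    parts-cliqueMatched : ∀ {j k} (as : Vec (Fin V) j) (bs : Vec (Fin V) k) → InClique as → Unique (V.toList (as V.++ bs)) →
          CliqueMatched (V.map part as) (V.map part bs)
    parts-cliqueMatched [] bs tt u = tt
    parts-cliqueMatched (a ∷ as) bs ((i , refl) , ak) (a∉ ∷ u) =
      (λ zin → subst (MatchedInto* _) (VP.map-++ part as bs) (parts-matchedInto (as V.++ bs) i (part-lab zin) a∉)) ,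
          parts-cliqueMatched as bs ak u

    numHColorings-≥ : falling m p * cycleCount (m ∸ p) k' ≤ numHColorings ℋ
    numHColorings-≥ = begin
      falling m p * cycleCount (m ∸ p) k'         ≤⟨ peel-≥ m cliqueParts cycleParts (cycleCount (m ∸ p) k')
                                                       (parts-uniqueAtLeast cliqueVertices)
                                                           (parts-uniqueAtLeast cycleVertices)
                                                       (parts-cliqueMatched cliqueVertices cycleVertices
                                                           (InClique-tabulate id) vertices-unique)
                                                       (cycleParts-bounded (m ∸ p)) ⟩
      #transversals (cliqueParts V.++ cycleParts) ≡⟨ cong #transversals (sym parts-allFin) ⟩
      #transversals (parts (V.allFin V))          ≤⟨ #transversals-≤-numHColorings (V.allFin V) (allFin-unique V) ⟩
      numHColorings ℋ                             ∎
      where open ≤-Reasoning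

  module UpperBound (p L : ℕ) (G : Graph (p + suc L)) (G≡join : ∀ x y → adj G x y ≡ joinAdj p (suc L) x y)
            (k' : ℕ) (cycle-length : suc L ≡ 3 + k') (k-even : ClosedForm.even k' ≡ true) (m : ℕ) where
    open Layout p L
    open CanonicalCover.Canonical G m
    open CanonicalCover using (≢⇒==-false)
    open Conflicts canonicalAdj using (#transversals)

    R-mk : ∀ u v a b → ¬ u ≡ v → canonicalAdj (combine u a) (combine v b) ≡ (adj G u v ∧ ⌊ a FinP.≟ b ⌋)
    R-mk u v a b ne rewrite vertexOf-combine u a | vertexOf-combine v b | colourOf-combine u a | colourOf-combine v b | ≢⇒==-false ne = refl

    open CanonicalCount.ProductCover (FinP._≟_ {NN}) canonicalAdj (FinP._≟_ {m}) combine (adj G) R-mk (Graph.irrefl G)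
      using (fibre; peel-≤; AdjacentToAll; CliqueBefore; module CanonicalCycle)

    adjacent⇒A : ∀ {i l} → i < n' → l < n' → CycleAdjacent n' i l → adj G (cycleVertex i) (cycleVertex l) ≡ true
    adjacent⇒A lt lt' c = trans (G≡join _ _) (cycleVertex-adjacent⁺ lt lt' c)

    A⇒adjacent : ∀ {i l} → i < n' → l < n' → adj G (cycleVertex i) (cycleVertex l) ≡ true → CycleAdjacent n' i l
    A⇒adjacent lt lt' e = cycleVertex-adjacent⁻ lt lt' (trans (sym (G≡join _ _)) e)

    open CanonicalCycle cycleVertex n' adjacent⇒A A⇒adjacent cycleVertex-injective using (cycleFibres; canonical-cycle-≤)

    adjacentToAll : ∀ {k} (i : Fin p) (bs : Vec (Fin V) k) → All (λ w → ¬ i ↑ˡ n' ≡ w) (V.toList bs) →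
        AdjacentToAll (i ↑ˡ n') bs
    adjacentToAll i [] [] = tt
    adjacentToAll i (b ∷ bs) (ne ∷ al) = trans (G≡join _ _) (joinAdj-clique i b (λ e → ne (sym e))) , adjacentToAll i bs al

    cliqueBefore : ∀ {j k} (as : Vec (Fin V) j) (bs : Vec (Fin V) k) → InClique as → Unique
        (V.toList (as V.++ bs)) → CliqueBefore as bs
    cliqueBefore [] bs tt u = tt
    cliqueBefore (a ∷ as) bs ((i , refl) , ak) (a∉ ∷ u) = adjacentToAll i (as V.++ bs) a∉ , cliqueBefore as bs ak u

    cycleFibres-subst : ∀ {n1 n2} (e : n1 ≡ n2) (Q : List (Fin m)) → #transversals
        (cycleFibres Q 0 n1) ≡ #transversals (cycleFibres Q 0 n2)
    cycleFibres-subst refl Q = refl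

    fibres-cycle-≤ : ∀ Q' → Unique Q' → length Q' ≡ m ∸ p → #transversals
        (V.map (fibre Q') cycleVertices) ≤ cycleCount (m ∸ p) k'
    fibres-cycle-≤ Q' u l = begin
        #transversals (V.map (fibre Q') cycleVertices) ≡⟨ cong #transversals
            (sym (VP.map-∘ (fibre Q') cycleVertex (upFrom 0 n'))) ⟩
        #transversals (cycleFibres Q' 0 n') ≡⟨ cycleFibres-subst cycle-length Q' ⟩
        #transversals (cycleFibres Q' 0 (3 + k')) ≤⟨ canonical-cycle-≤ k' Q' u (sym cycle-length) k-even ⟩
        cycleCount (length Q') k' ≡⟨ cong (λ z → cycleCount z k') l ⟩
        cycleCount (m ∸ p) k' ∎
      where open ≤-Reasoning

    chromPoly-≤ : chromPoly G m ≤ falling m p * cycleCount (m ∸ p) k'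
    chromPoly-≤ = begin
      chromPoly G m                                                          ≤⟨ chromPoly-≤-#transversals ⟩
      #transversals (V.map (colourFibre (allFin m)) (V.allFin V))            ≡⟨ cong
          (#transversals ∘ V.map (fibre (allFin m))) allFin-join ⟩
      #transversals (V.map (fibre (allFin m)) (cliqueVertices V.++ cycleVertices))
        ≤⟨ peel-≤ m (allFin m) (UP.allFin⁺ m) (LP.length-tabulate id) cliqueVertices cycleVertices
                  (cliqueBefore cliqueVertices cycleVertices (InClique-tabulate id) vertices-unique)
                      (cycleCount (m ∸ p) k') fibres-cycle-≤ ⟩
      falling m p * cycleCount (m ∸ p) k'                                    ∎
      where open ≤-Reasoning

module Arithmetic where

  open Chains using (chainTotal; chainLeast; chainRest)
  open CliquePeeling using (falling)
  open CycleBound using (cycleCount)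
  open ClosedForm using (even)

  even-double : ∀ k → even (k + k) ≡ true
  even-double zero = refl
  even-double (suc k) rewrite +-suc k k | BoolP.not-involutive (even (k + k)) = even-double k

  odd-cycle-length : ∀ k → suc (2 * suc k) ≡ 3 + (k + k)
  odd-cycle-length k = cong (2 +_) (trans (cong (k +_) (+-identityʳ (suc k))) (+-suc k k))

  falling-positive : ∀ j r → 0 < falling (j + suc r) j
  falling-positive zero r = s≤s z≤n
  falling-positive (suc j) r = *-mono-≤ {1} {suc (j + suc r)} (s≤s z≤n) (falling-positive j r)

  falling-zero : ∀ c j → c < j → falling c j ≡ 0
  falling-zero zero (suc j) _ = refl
  falling-zero (suc c) (suc j) (s≤s lt) = trans (cong (suc c *_) (falling-zero c j lt)) (*-zeroʳ (suc c))

  chainBounds-3-positive : ∀ j → 1 ≤ chainTotal 3 j × 1 ≤ chainRest 3 j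
  chainBounds-3-positive zero = s≤s z≤n , s≤s z≤n
  chainBounds-3-positive (suc j) with chainBounds-3-positive j
  ... | total≥1 , _ = ≤-trans total≥1 (m≤m+n (chainTotal 3 j) _) ,
                      ≤-trans total≥1 (≤-trans (m≤m+n (chainTotal 3 j) 0) (m≤m+n (chainTotal 3 j + 0) (chainLeast 3 j)))

  cycleCount-3-positive : ∀ k → 0 < cycleCount 3 k
  cycleCount-3-positive k = *-mono-≤ {1} {3} (s≤s z≤n) (proj₂ (chainBounds-3-positive (suc k)))

module JoinOfCliqueAndOddCycle (p k : ℕ) (G : Graph (p + suc (2 * suc k)))
                               (G≡join : ∀ x y → adj G x y ≡ joinAdj p (suc (2 * suc k)) x y) where

  open CliquePeeling using (falling)
  open CycleBound using (cycleCount; cycleCount-≤2)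
  open Arithmetic

  bound : ℕ → ℕ
  bound m = falling m p * cycleCount (m ∸ p) (k + k)

  bound-≤-numHColorings : ∀ m (ℋ : Cover G m) → bound m ≤ numHColorings ℋ
  bound-≤-numHColorings m ℋ = Join.LowerBound.numHColorings-≥ p _ G G≡join (k + k) (odd-cycle-length k) ℋ

  chromPoly-≤-bound : ∀ m → chromPoly G m ≤ bound m
  chromPoly-≤-bound m = Join.UpperBound.chromPoly-≤ p _ G G≡join (k + k) (odd-cycle-length k) (even-double k) m

  canonicalCover : ∀ m → Cover G m
  canonicalCover m = CanonicalCover.Canonical.canonicalCover G m

  numHColorings-canonical-≤ : ∀ m → numHColorings (canonicalCover m) ≤ chromPoly G m
  numHColorings-canonical-≤ (suc m) = CanonicalCover.CanonicalColorings.numHColorings-canonical-≤ G m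
  numHColorings-canonical-≤ zero =
    ≤-trans (≤-reflexive (cong length (filter-none (isHColoring? (canonicalCover 0)) (All.tabulate noColoring)))) z≤n
    where
    -- With no colours the cover has no vertices at all, but an H-coloring needs one per vertex of G.
    noColoring : ∀ {S} → S ∈ allSubsets (N (canonicalCover 0)) → ¬ IsHColoring (canonicalCover 0) S
    noColoring {S} _ (∣S∣≡n , _) = 1+n≰n (begin
      1                      ≤⟨ m≤n+m 1 p ⟩
      p + 1                  ≤⟨ +-monoʳ-≤ p (s≤s z≤n) ⟩
      p + suc (2 * suc k)    ≡⟨ sym ∣S∣≡n ⟩
      ∣ S ∣                  ≤⟨ SubP.∣p∣≤n S ⟩
      (p + suc (2 * suc k)) * 0 ≡⟨ *-zeroʳ (p + suc (2 * suc k)) ⟩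
      0                      ∎)
      where open ≤-Reasoning

  numHColorings-canonical : ∀ m → numHColorings (canonicalCover m) ≡ chromPoly G m
  numHColorings-canonical m = ≤-antisym (numHColorings-canonical-≤ m)
                                        (≤-trans (chromPoly-≤-bound m) (bound-≤-numHColorings m (canonicalCover m)))

  dpEqualsChrom : ∀ m → DPEqualsChrom G m
  dpEqualsChrom m = (canonicalCover m , numHColorings-canonical m) ,
                    λ ℋ → ≤-trans (chromPoly-≤-bound m) (bound-≤-numHColorings m ℋ)

  bound-positive : 0 < bound (3 + p)
  bound-positive = *-mono-≤ {1} (subst (λ z → 0 < falling z p) (+-comm p 3) (falling-positive p 2))
                                (subst (λ z → 0 < cycleCount z (k + k)) (sym (m+n∸n≡m 3 p)) (cycleCount-3-positive (k + k)))

  bound-zero : ∀ c → c < 3 + p → bound c ≡ 0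
  bound-zero c c<3+p with c <? p
  ... | yes c<p = cong (_* cycleCount (c ∸ p) (k + k)) (falling-zero c p c<p)
  ... | no c≮p = trans (cong (falling c p *_) (cycleCount-≤2 (c ∸ p) (k + k) c∸p≤2)) (*-zeroʳ (falling c p))
    where
    c∸p≤2 : c ∸ p ≤ 2
    c∸p≤2 = ≤-pred (≤-trans (≤-reflexive (sym (+-∸-assoc 1 (≮⇒≥ c≮p))))
                            (≤-trans (∸-monoˡ-≤ p c<3+p) (≤-reflexive (m+n∸n≡m 3 p))))

  chromaticNumber : IsChromaticNumber G (3 + p)
  chromaticNumber =
    ≤-trans bound-positive (≤-trans (bound-≤-numHColorings (3 + p) (canonicalCover (3 + p)))
                                    (≤-reflexive (numHColorings-canonical (3 + p)))) ,
    λ c c<3+p → n≤0⇒n≡0 (subst (chromPoly G c ≤_) (bound-zero c c<3+p) (chromPoly-≤-bound c))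

  tauDP : IsTauDP G (3 + p)
  tauDP = (λ c χ≡c → ≮⇒≥ (λ c<3+p → <⇒≢ (proj₁ chromaticNumber) (sym (proj₂ χ≡c (3 + p) c<3+p)))) ,
          (λ m _ → dpEqualsChrom m) ,
          (λ t′ χ≤t′ t′<3+p _ → <⇒≱ t′<3+p (χ≤t′ (3 + p) chromaticNumber))

lemma2p3 : (p k : ℕ) → 1 ≤ k →
           (G : Graph (p + suc (2 * k))) →
           (∀ x y → adj G x y ≡ joinAdj p (suc (2 * k)) x y) →
           (∀ m → DPEqualsChrom G m) × IsTauDP G (3 + p) × IsChromaticNumber G (3 + p)
lemma2p3 p (suc k) _ G G≡join = dpEqualsChrom , tauDP , chromaticNumber
  where open JoinOfCliqueAndOddCycle p k G G≡join
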